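{- Let $a_{n,k,r}$ denote the number of run-sorted permutations of $[n]$ having $k$ runs and $r$ right-to-left minima ($a_{0,0,0}=1$), and let $A(x,y,z)=\sum_{n,k,r\ge0}a_{n,k,r}\frac{x^n}{n!}y^kz^r$. Then $$\frac{\partial A}{\partial x}=yz\,e^{xz+yz(-x-1)+yze^x},$$ with $\frac{\partial A}{\partial x}\big|_{x=0}=yz$.
   Context: A run of a permutation is a maximal increasing factor of consecutive letters. A permutation of $[n]$ is run-sorted if it is the concatenation of the blocks of a set partition of $[n]$ in block representation (elements increasing in each block, blocks ordered by increasing minima); equivalently the minima of its successive runs are increasing. A right-to-left minimum of $\pi=\pi_1\cdots\pi_n$ is an entry $\pi_i$ with $\pi_i<\pi_j$ for all $j>i$. -}

module Defs where

open import Data.Bool using (Bool; true; false; _∧_; if_then_else_)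
open import Data.Nat as ℕ using (ℕ; zero; suc; _<ᵇ_; _≡ᵇ_; _!)
open import Data.Nat.Properties using (_!≢0)
open import Data.Integer using (+_)
open import Data.List using (List; []; _∷_; length; map; concatMap; filterᵇ; upTo)
open import Data.Rational using (ℚ; 0ℚ; 1ℚ; _+_; _*_; -_; _/_)

-- Permutations of [n] = {1,…,n}, as words π₁⋯πₙ (lists of ℕ)

words : ℕ → ℕ → List (List ℕ)
words m zero    = [] ∷ []
words m (suc n) = concatMap (λ x → map (x ∷_) (words m n)) (map suc (upTo m))

all : {A : Set} → (A → Bool) → List A → Bool
all p []       = true
all p (x ∷ xs) = p x ∧ all p xs

distinct : List ℕ → Bool
distinct []       = true
distinct (x ∷ xs) = all (λ y → Data.Bool.not (x ≡ᵇ y)) xs ∧ distinct xs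

perms : ℕ → List (List ℕ)
perms n = filterᵇ distinct (words n n)

-- Runs: maximal increasing factors of consecutive letters

private
  addFront : ℕ → List (List ℕ) → List (List ℕ)
  addFront x []                  = (x ∷ []) ∷ []
  addFront x ([] ∷ rs)           = (x ∷ []) ∷ rs
  addFront x ((y ∷ r) ∷ rs) = if x <ᵇ y then (x ∷ y ∷ r) ∷ rs
                                        else (x ∷ []) ∷ (y ∷ r) ∷ rs

runs : List ℕ → List (List ℕ)
runs []       = []
runs (x ∷ xs) = addFront x (runs xs)

nRuns : List ℕ → ℕ
nRuns π = length (runs π)

-- first letters (= minima) of the runs
runMinima : List ℕ → List ℕ
runMinima π = go (runs π)
  where
  go : List (List ℕ) → List ℕ
  go []             = []
  go ([] ∷ rs)      = go rs
  go ((x ∷ _) ∷ rs) = x ∷ go rs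

strictlyIncreasing : List ℕ → Bool
strictlyIncreasing []           = true
strictlyIncreasing (x ∷ [])     = true
strictlyIncreasing (x ∷ y ∷ xs) = (x <ᵇ y) ∧ strictlyIncreasing (y ∷ xs)

runSorted : List ℕ → Bool
runSorted π = strictlyIncreasing (runMinima π)

nRLmin : List ℕ → ℕ
nRLmin []       = 0
nRLmin (x ∷ xs) = (if all (x <ᵇ_) xs then 1 else 0) ℕ.+ nRLmin xs

a : ℕ → ℕ → ℕ → ℕ
a n k r = length (filterᵇ (λ π → runSorted π ∧ (nRuns π ≡ᵇ k) ∧ (nRLmin π ≡ᵇ r)) (perms n))

-- Formal power series in x, y, z over ℚ:  F n k r = [xⁿ yᵏ zʳ] F

Series : Set
Series = ℕ → ℕ → ℕ → ℚ

sumTo : ℕ → (ℕ → ℚ) → ℚ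
sumTo zero    f = f 0
sumTo (suc n) f = sumTo n f + f (suc n)

inv! : ℕ → ℚ
inv! m = (+ 1) / (m !) where instance _ = m !≢0

const : ℚ → Series
const c zero zero zero = c
const c _    _    _    = 0ℚ

X Y Z : Series
X 1 0 0 = 1ℚ
X _ _ _ = 0ℚ
Y 0 1 0 = 1ℚ
Y _ _ _ = 0ℚ
Z 0 0 1 = 1ℚ
Z _ _ _ = 0ℚ

infixl 6 _⊕_
infixl 7 _⊗_

_⊕_ : Series → Series → Series
(F ⊕ G) n k r = F n k r + G n k r

⊖_ : Series → Series
(⊖ F) n k r = - F n k r

_⊗_ : Series → Series → Series
(F ⊗ G) n k r =
  sumTo n λ i → sumTo k λ j → sumTo r λ l →
    F i j l * G (n ℕ.∸ i) (k ℕ.∸ j) (r ℕ.∸ l)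

pow : Series → ℕ → Series
pow F zero    = const 1ℚ
pow F (suc m) = F ⊗ pow F m

-- exponential of a series G with zero constant term: Σ_m G^m / m!
-- (G^m has no monomials of total degree < m, so the coefficient of
--  xⁿyᵏzʳ only receives contributions from m ≤ n + k + r)
expS : Series → Series
expS G n k r = sumTo (n ℕ.+ k ℕ.+ r) λ m → inv! m * pow G m n k r

expX : Series
expX n zero zero = inv! n
expX _ _    _    = 0ℚ

∂x : Series → Series
∂x F n k r = (+ suc n / 1) * F (suc n) k r

A : Series
A n k r = (+ a n k r / 1) * inv! n

exponent : Series
exponent = X ⊗ Z ⊕ Y ⊗ Z ⊗ (⊖ X ⊕ ⊖ const 1ℚ) ⊕ Y ⊗ Z ⊗ expX

-- Every permutation of [n+1] is a first letter h followed by a word order-isomorphic to a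
-- permutation of [n]. Tracking runs, run minima and right-to-left minima through this
-- decomposition: a run-sorted permutation starts with 1, and deleting that 1 and sorting by the
-- next letter gives, for a⁺(n, j, b) = a(n+1, j+1, b+1),
--   a⁺(n+1, j, b+1) = a⁺(n, j, b) + Σ_{i ≥ 1} C(n, i) a⁺(n−i, j−1, b),   a⁺(n+1, j, 0) = 0.
-- On the other side the exponent is z·L with L = x + y(eˣ − 1 − x), so the coefficient of zᵇ in
-- its exponential is Lᵇ/b!. Writing Lᵇ⁺¹ = ∫ (b+1)·L′·Lᵇ with L′ = 1 + y(eˣ − 1) shows that the
-- coefficients n![xⁿyʲ]Lᵇ obey the same recurrence as b!·a⁺(n, j, b); hence
-- [xⁿyʲzᵇ] e^{zL} = a⁺(n, j, b)/n!, which is the coefficient of xⁿyʲ⁺¹zᵇ⁺¹ in ∂A/∂x.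

module Submission where

open import Defs
open import Data.Product using (_×_; _,_)
open import Relation.Binary.PropositionalEquality using (_≡_)
open import Data.Nat using (ℕ)

open import Algebra.Structures using (IsCommutativeSemiring; IsCommutativeRing)
open import Algebra.Bundles using (CommutativeSemigroup; CommutativeMonoid)
import Algebra.Properties.CommutativeSemigroup as CommutativeSemigroupProperties
open import Data.Bool using (Bool; true; false; _∧_; not; if_then_else_; T)
open import Data.Bool.Properties using (T-≡; ∧-zeroʳ)
open import Data.Empty using (⊥-elim)
import Data.Nat as ℕ
open import Data.Nat using (zero; suc; _≤_; _<_; _∸_; _≤ᵇ_; _<ᵇ_; _≡ᵇ_; z≤n; s≤s)
open import Data.Nat.Properties
  using (≤-refl; m≤n⇒m≤1+n; _≟_; <-irrefl; ≤∧≢⇒<; m∸n+n≡m; m≤n+m; +-∸-assoc; n∸n≡0; _≤?_; ≰⇒>;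
         ≤⇒≤ᵇ; ≤ᵇ-reflects-≤; <⇒≱; <⇒<ᵇ; <ᵇ-reflects-<; ≤⇒≯; ≡⇒≡ᵇ; ≡ᵇ⇒≡)
open import Function using (_∘_; id; Equivalence)
open import Relation.Binary.PropositionalEquality
  using (_≢_; ≢-sym; refl; sym; trans; cong; cong₂; subst; module ≡-Reasoning)
open import Relation.Nullary using (yes; no)
open import Relation.Nullary.Reflects using (ofʸ; ofⁿ)

≤ᵇ-true : ∀ {m n} → m ≤ n → (m ≤ᵇ n) ≡ true
≤ᵇ-true m≤n = Equivalence.to T-≡ (≤⇒≤ᵇ m≤n)

≤ᵇ-false : ∀ {m n} → n < m → (m ≤ᵇ n) ≡ false
≤ᵇ-false {m} {n} n<m with m ≤ᵇ n | ≤ᵇ-reflects-≤ m n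
... | false | _       = refl
... | true  | ofʸ m≤n = ⊥-elim (<⇒≱ n<m m≤n)

≤ᵇ-suc : ∀ {m n} → m ≢ suc n → (m ≤ᵇ n) ≡ (m ≤ᵇ suc n)
≤ᵇ-suc {m} {n} m≢1+n with m ≤? n
... | yes m≤n = trans (≤ᵇ-true m≤n) (sym (≤ᵇ-true (m≤n⇒m≤1+n m≤n)))
... | no  m≰n = trans (≤ᵇ-false (≰⇒> m≰n)) (sym (≤ᵇ-false (≤∧≢⇒< (≰⇒> m≰n) (m≢1+n ∘ sym))))

s≤ᵇs : ∀ m n → (suc m ≤ᵇ suc n) ≡ (m ≤ᵇ n)
s≤ᵇs zero    n = refl
s≤ᵇs (suc m) n = refl

<ᵇ-true : ∀ {m n} → m < n → (m <ᵇ n) ≡ true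
<ᵇ-true m<n = Equivalence.to T-≡ (<⇒<ᵇ m<n)

<ᵇ-false : ∀ {m n} → n ≤ m → (m <ᵇ n) ≡ false
<ᵇ-false {m} {n} n≤m with m <ᵇ n | <ᵇ-reflects-< m n
... | false | _       = refl
... | true  | ofʸ m<n = ⊥-elim (≤⇒≯ n≤m m<n)

≡ᵇ-refl : ∀ n → (n ≡ᵇ n) ≡ true
≡ᵇ-refl n = Equivalence.to T-≡ (≡⇒≡ᵇ n n refl)

≡ᵇ-false : ∀ {m n} → m ≢ n → (m ≡ᵇ n) ≡ false
≡ᵇ-false {m} {n} m≢n with m ≡ᵇ n in eq
... | false = refl
... | true  = ⊥-elim (m≢n (≡ᵇ⇒≡ m n (subst T (sym eq) _)))

∧-∧-false : ∀ a b → a ∧ b ∧ false ≡ false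
∧-∧-false true  b     = ∧-zeroʳ b
∧-∧-false false _     = refl

𝟙 : Bool → ℕ
𝟙 b = if b then 1 else 0

-- The sum is a parameter, given by its defining equations, so that both Defs.sumTo over ℚ and
-- sumToℕ below are instances.
module FiniteSum
  {A : Set} {_+_ _*_ : A → A → A} {0# 1# : A}
  (isCommutativeSemiring : IsCommutativeSemiring _≡_ _+_ _*_ 0# 1#)
  (sum : ℕ → (ℕ → A) → A)
  (sum-zero : ∀ f → sum 0 f ≡ f 0)
  (sum-suc : ∀ n f → sum (suc n) f ≡ sum n f + f (suc n))
  where

  open IsCommutativeSemiring isCommutativeSemiring
    using (+-identityʳ; +-identityˡ; +-assoc; +-comm; *-comm; *-assoc; distribˡ; +-isCommutativeSemigroup)
  private
    +-commutativeSemigroup : CommutativeSemigroup _ _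
    +-commutativeSemigroup = record { isCommutativeSemigroup = +-isCommutativeSemigroup }

  open CommutativeSemigroupProperties +-commutativeSemigroup using (interchange)
  open ≡-Reasoning

  sum-cong : ∀ n {f g : ℕ → A} → (∀ i → i ≤ n → f i ≡ g i) → sum n f ≡ sum n g
  sum-cong zero {f} {g} f≗g rewrite sum-zero f | sum-zero g = f≗g 0 z≤n
  sum-cong (suc n) {f} {g} f≗g rewrite sum-suc n f | sum-suc n g =
    cong₂ _+_ (sum-cong n (λ i i≤n → f≗g i (m≤n⇒m≤1+n i≤n))) (f≗g (suc n) ≤-refl)

  sum-vanishes : ∀ n {f : ℕ → A} → (∀ i → i ≤ n → f i ≡ 0#) → sum n f ≡ 0#
  sum-vanishes zero {f} f≗0 rewrite sum-zero f = f≗0 0 z≤n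
  sum-vanishes (suc n) {f} f≗0 rewrite sum-suc n f
    | sum-vanishes n (λ i i≤n → f≗0 i (m≤n⇒m≤1+n i≤n)) | f≗0 (suc n) ≤-refl = +-identityʳ 0#

  sum-distrib-+ : ∀ n (f g : ℕ → A) → sum n (λ i → f i + g i) ≡ sum n f + sum n g
  sum-distrib-+ zero f g rewrite sum-zero f | sum-zero g = sum-zero _
  sum-distrib-+ (suc n) f g rewrite sum-suc n f | sum-suc n g | sum-suc n (λ i → f i + g i)
    | sum-distrib-+ n f g = interchange (sum n f) (sum n g) (f (suc n)) (g (suc n))

  *-distribˡ-sum : ∀ n c (f : ℕ → A) → c * sum n f ≡ sum n (λ i → c * f i)
  *-distribˡ-sum zero c f rewrite sum-zero f = sym (sum-zero _)
  *-distribˡ-sum (suc n) c f rewrite sum-suc n f | sum-suc n (λ i → c * f i) =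
    trans (distribˡ c (sum n f) (f (suc n))) (cong (_+ (c * f (suc n))) (*-distribˡ-sum n c f))

  *-distribʳ-sum : ∀ n c (f : ℕ → A) → sum n f * c ≡ sum n (λ i → f i * c)
  *-distribʳ-sum n c f =
    trans (*-comm (sum n f) c) (trans (*-distribˡ-sum n c f) (sum-cong n (λ i _ → *-comm c (f i))))

  sum-single : ∀ n a {f : ℕ → A} → (∀ i → i ≢ a → f i ≡ 0#) → sum n f ≡ (if a ≤ᵇ n then f a else 0#)
  sum-single zero zero {f} f≗0 = sum-zero f
  sum-single zero (suc a) {f} f≗0 = trans (sum-zero f) (f≗0 0 λ ())
  sum-single (suc n) a {f} f≗0 with a ≟ suc n
  ... | yes refl rewrite sum-suc n f | ≤ᵇ-true (≤-refl {suc n})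
    | sum-vanishes n (λ i i≤n → f≗0 i (λ i≡1+n → <-irrefl i≡1+n (s≤s i≤n))) = +-identityˡ (f (suc n))
  ... | no a≢1+n rewrite sum-suc n f | sum-single n a f≗0 | f≗0 (suc n) (a≢1+n ∘ sym) =
    trans (+-identityʳ _) (cong (if_then f a else 0#) (≤ᵇ-suc a≢1+n))

  sum-single≤ : ∀ n a {f : ℕ → A} → a ≤ n → (∀ i → i ≢ a → f i ≡ 0#) → sum n f ≡ f a
  sum-single≤ n a {f} a≤n f≗0 = trans (sum-single n a f≗0) (cong (if_then f a else 0#) (≤ᵇ-true a≤n))

  sum-unshift : ∀ n (f : ℕ → A) → sum (suc n) f ≡ f 0 + sum n (f ∘ suc)
  sum-unshift zero f rewrite sum-suc 0 f | sum-zero f | sum-zero (f ∘ suc) = refl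
  sum-unshift (suc n) f rewrite sum-suc (suc n) f | sum-unshift n f | sum-suc n (f ∘ suc) =
    +-assoc (f 0) (sum n (f ∘ suc)) (f (suc (suc n)))

  sum-unshift-within : ∀ n (f : ℕ → A) → f (suc n) ≡ 0# → sum n f ≡ f 0 + sum n (f ∘ suc)
  sum-unshift-within n f f[1+n]≡0 = begin
    sum n f                  ≡⟨ +-identityʳ (sum n f) ⟨
    sum n f + 0#             ≡⟨ cong (sum n f +_) f[1+n]≡0 ⟨
    sum n f + f (suc n)      ≡⟨ sum-suc n f ⟨
    sum (suc n) f            ≡⟨ sum-unshift n f ⟩
    f 0 + sum n (f ∘ suc)    ∎

  sum-extend : ∀ m n {f : ℕ → A} → m ≤ n → (∀ i → m < i → f i ≡ 0#) → sum n f ≡ sum m f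
  sum-extend m n {f} m≤n f≗0 = trans (cong (λ k → sum k f) (sym (m∸n+n≡m m≤n))) (extend (n ∸ m))
    where
    extend : ∀ d → sum (d ℕ.+ m) f ≡ sum m f
    extend zero = refl
    extend (suc d) rewrite sum-suc (d ℕ.+ m) f | extend d | f≗0 (suc (d ℕ.+ m)) (s≤s (m≤n+m m d)) =
      +-identityʳ (sum m f)

  sum-swap : ∀ n m (f : ℕ → ℕ → A) → sum n (λ i → sum m (f i)) ≡ sum m (λ j → sum n (λ i → f i j))
  sum-swap zero m f rewrite sum-zero (λ i → sum m (f i)) = sum-cong m (λ j _ → sym (sum-zero (λ i → f i j)))
  sum-swap (suc n) m f rewrite sum-suc n (λ i → sum m (f i)) | sum-swap n m f = begin
    sum m (λ j → sum n (λ i → f i j)) + sum m (f (suc n))   ≡⟨ sum-distrib-+ m _ _ ⟨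
    sum m (λ j → sum n (λ i → f i j) + f (suc n) j)         ≡⟨ sum-cong m (λ j _ → sym (sum-suc n (λ i → f i j))) ⟩
    sum m (λ j → sum (suc n) (λ i → f i j))                 ∎

  sum-reverse : ∀ n (f : ℕ → A) → sum n f ≡ sum n (λ i → f (n ∸ i))
  sum-reverse zero f = sum-cong 0 (λ { .0 z≤n → refl })
  sum-reverse (suc n) f = begin
    sum (suc n) f                                ≡⟨ sum-unshift n f ⟩
    f 0 + sum n (f ∘ suc)                        ≡⟨ cong (f 0 +_) (sum-reverse n (f ∘ suc)) ⟩
    f 0 + sum n (λ i → f (suc (n ∸ i)))          ≡⟨ +-comm (f 0) _ ⟩
    sum n (λ i → f (suc (n ∸ i))) + f 0          ≡⟨ cong₂ _+_ (sum-cong n (λ i i≤n → cong f (sym (+-∸-assoc 1 i≤n))))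
                                                              (cong f (sym (n∸n≡0 (suc n)))) ⟩
    sum n (λ i → f (suc n ∸ i)) + f (suc n ∸ suc n) ≡⟨ sum-suc n (λ i → f (suc n ∸ i)) ⟨
    sum (suc n) (λ i → f (suc n ∸ i))            ∎

  sum-*-sum-exchange : ∀ n m (g : ℕ → A) (h : ℕ → ℕ → A) (k : ℕ → A) →
    sum n (λ i → g i * sum m (λ j → h i j * k j)) ≡ sum m (λ j → sum n (λ i → g i * h i j) * k j)
  sum-*-sum-exchange n m g h k = begin
    sum n (λ i → g i * sum m (λ j → h i j * k j))
      ≡⟨ sum-cong n (λ i _ → *-distribˡ-sum m (g i) _) ⟩
    sum n (λ i → sum m (λ j → g i * (h i j * k j)))
      ≡⟨ sum-swap n m _ ⟩
    sum m (λ j → sum n (λ i → g i * (h i j * k j)))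
      ≡⟨ sum-cong m (λ j _ → sum-cong n (λ i _ → sym (*-assoc (g i) (h i j) (k j)))) ⟩
    sum m (λ j → sum n (λ i → (g i * h i j) * k j))     ≡⟨ sum-cong m (λ j _ → *-distribʳ-sum n (k j) _) ⟨
    sum m (λ j → sum n (λ i → g i * h i j) * k j)
      ∎

module Counting where

  open import Data.Nat using (_+_; _*_; _!; NonZero; z<s; s<s)
  open import Data.Nat.Properties
  open import Data.Nat.Combinatorics using (nCk+nC[k+1]≡[n+1]C[k+1]; k>n⇒nCk≡0; k![n∸k]!∣n!)
    renaming (_C_ to _choose_)
  open import Data.Nat.Combinatorics.Specification using (nCk≡n!/k![n-k]!)
  open import Data.Nat.DivMod using (m/n*n≡m)
  open import Data.List using (List; []; _∷_; _++_; drop; map; length; concatMap; filterᵇ; applyUpTo; upTo)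
  open import Data.Product using (∃; ∃₂; proj₁; proj₂)
  open import Data.Bool.Properties using (∧-assoc; ∧-comm)
  open import Data.List.Properties using (drop-map; map-applyUpTo)
  open import Data.List.Membership.Propositional using (_∈_)
  open import Data.List.Membership.Propositional.Properties using (∈-map⁺)
  open import Data.List.Relation.Unary.All as All using (All; []; _∷_)
  import Data.List.Relation.Unary.All.Properties as All
  open import Data.List.Relation.Unary.Any using (here; there)
  open ≡-Reasoning

  sumToℕ : ℕ → (ℕ → ℕ) → ℕ
  sumToℕ zero    f = f 0
  sumToℕ (suc n) f = sumToℕ n f + f (suc n)

  sumToℕ-zero : ∀ f → sumToℕ 0 f ≡ f 0
  sumToℕ-zero f = refl

  sumToℕ-suc : ∀ n f → sumToℕ (suc n) f ≡ sumToℕ n f + f (suc n)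
  sumToℕ-suc n f = refl

  open FiniteSum +-*-isCommutativeSemiring sumToℕ sumToℕ-zero sumToℕ-suc

  -- Pascal's rule, so that C n k computes by pattern matching.
  C : ℕ → ℕ → ℕ
  C zero    zero    = 1
  C zero    (suc k) = 0
  C (suc n) zero    = 1
  C (suc n) (suc k) = C n k + C n (suc k)

  C≡choose : ∀ n k → C n k ≡ n choose k
  C≡choose zero    zero    = refl
  C≡choose zero    (suc k) = refl
  C≡choose (suc n) zero    = refl
  C≡choose (suc n) (suc k) =
    trans (cong₂ _+_ (C≡choose n k) (C≡choose n (suc k))) (nCk+nC[k+1]≡[n+1]C[k+1] n k)

  C-zeroʳ : ∀ n → C n 0 ≡ 1
  C-zeroʳ zero    = refl
  C-zeroʳ (suc n) = refl

  C-vanishes : ∀ {n k} → n < k → C n k ≡ 0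
  C-vanishes {n} {k} n<k = trans (C≡choose n k) (k>n⇒nCk≡0 n<k)

  C*[k!*[n∸k]!]≡n! : ∀ {n k} → k ≤ n → C n k * (k ! * (n ∸ k) !) ≡ n !
  C*[k!*[n∸k]!]≡n! {n} {k} k≤n = begin
    C n k * (k ! * (n ∸ k) !)   ≡⟨ cong (_* (k ! * (n ∸ k) !)) (trans (C≡choose n k) (nCk≡n!/k![n-k]! k≤n)) ⟩
    _                           ≡⟨ m/n*n≡m {{k !* (n ∸ k) !≢0}} (k![n∸k]!∣n! k≤n) ⟩
    n !                         ∎

  hockey-stick : ∀ n k → sumToℕ n (λ m → C m k) ≡ C (suc n) (suc k)
  hockey-stick zero    zero    = refl
  hockey-stick zero    (suc k) = refl
  hockey-stick (suc n) k rewrite hockey-stick n k = +-comm (C n k + C n (suc k)) (C (suc n) k)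

  m∸n∸o≡m∸o∸n : ∀ m n o → m ∸ n ∸ o ≡ m ∸ o ∸ n
  m∸n∸o≡m∸o∸n m n o = trans (∸-+-assoc m n o) (trans (cong (m ∸_) (+-comm n o)) (sym (∸-+-assoc m o n)))

  C*C*[i!*[j!*[n∸i∸j]!]]≡n! : ∀ {n i j} → i + j ≤ n →
    C n i * C (n ∸ i) j * (i ! * (j ! * (n ∸ i ∸ j) !)) ≡ n !
  C*C*[i!*[j!*[n∸i∸j]!]]≡n! {n} {i} {j} i+j≤n = begin
    C n i * C (n ∸ i) j * (i ! * (j ! * (n ∸ i ∸ j) !))
      ≡⟨ *-assoc (C n i) _ _ ⟩
    C n i * (C (n ∸ i) j * (i ! * (j ! * (n ∸ i ∸ j) !)))
      ≡⟨ cong (C n i *_) (x∙yz≈y∙xz (C (n ∸ i) j) (i !) _) ⟩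
    C n i * (i ! * (C (n ∸ i) j * (j ! * (n ∸ i ∸ j) !)))
      ≡⟨ cong (λ m → C n i * (i ! * m)) (C*[k!*[n∸k]!]≡n! (m+n≤o⇒n≤o∸m {i} i+j≤n)) ⟩
    C n i * (i ! * (n ∸ i) !)
      ≡⟨ C*[k!*[n∸k]!]≡n! (m+n≤o⇒m≤o i i+j≤n) ⟩
    n !
      ∎
    where
    open CommutativeSemigroupProperties *-commutativeSemigroup using (x∙yz≈y∙xz)
    m+n≤o⇒n≤o∸m : ∀ {m n o} → m + n ≤ o → n ≤ o ∸ m
    m+n≤o⇒n≤o∸m {m} {n} {o} m+n≤o = m+n≤o⇒m≤o∸n n (subst (_≤ o) (+-comm m n) m+n≤o)

  C*C-vanishes : ∀ {n i j} → n < i + j → C n i * C (n ∸ i) j ≡ 0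
  C*C-vanishes {n} {i} {j} n<i+j with i ≤? n
  ... | yes i≤n = trans (cong (C n i *_) (C-vanishes n∸i<j)) (*-zeroʳ (C n i))
    where
    n∸i<j : n ∸ i < j
    n∸i<j = +-cancelˡ-< i (n ∸ i) j (subst (_< i + j) (sym (m+[n∸m]≡n i≤n)) n<i+j)
  ... | no i≰n = cong (_* C (n ∸ i) j) (C-vanishes (≰⇒> i≰n))

  C*C-comm : ∀ n i j → C n i * C (n ∸ i) j ≡ C n j * C (n ∸ j) i
  C*C-comm n i j with i + j ≤? n
  ... | yes i+j≤n = *-cancelʳ-≡ _ _ (i ! * (j ! * (n ∸ i ∸ j) !)) {{factorials≢0}} (begin
    C n i * C (n ∸ i) j * (i ! * (j ! * (n ∸ i ∸ j) !))
      ≡⟨ C*C*[i!*[j!*[n∸i∸j]!]]≡n! i+j≤n ⟩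
    n !                                                  ≡⟨ C*C*[i!*[j!*[n∸i∸j]!]]≡n! (subst (_≤ n) (+-comm i j) i+j≤n) ⟨
    C n j * C (n ∸ j) i * (j ! * (i ! * (n ∸ j ∸ i) !))
      ≡⟨ cong (C n j * C (n ∸ j) i *_) (x∙yz≈y∙xz (j !) (i !) _) ⟩
    C n j * C (n ∸ j) i * (i ! * (j ! * (n ∸ j ∸ i) !))
      ≡⟨ cong (λ m → C n j * C (n ∸ j) i * (i ! * (j ! * m !))) (m∸n∸o≡m∸o∸n n j i) ⟩
    C n j * C (n ∸ j) i * (i ! * (j ! * (n ∸ i ∸ j) !))  ∎)
    where
    open CommutativeSemigroupProperties *-commutativeSemigroup using (x∙yz≈y∙xz)
    factorials≢0 : NonZero (i ! * (j ! * (n ∸ i ∸ j) !))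
    factorials≢0 = m*n≢0 (i !) _ {{i !≢0}} {{j !* (n ∸ i ∸ j) !≢0}}
  ... | no i+j≰n = trans (C*C-vanishes (≰⇒> i+j≰n)) (sym (C*C-vanishes (subst (n <_) (+-comm i j) (≰⇒> i+j≰n))))

  hockey-stick-from : ∀ n h k → sumToℕ n (λ i → 𝟙 (h ≤ᵇ i) * C (n ∸ i) k) ≡ C (suc n ∸ h) (suc k)
  hockey-stick-from n zero k = begin
    sumToℕ n (λ i → 1 * C (n ∸ i) k)    ≡⟨ sum-cong n (λ i _ → *-identityˡ (C (n ∸ i) k)) ⟩
    sumToℕ n (λ i → C (n ∸ i) k)        ≡⟨ sum-reverse n (λ i → C (n ∸ i) k) ⟩
    sumToℕ n (λ i → C (n ∸ (n ∸ i)) k)  ≡⟨ sum-cong n (λ i i≤n → cong (λ m → C m k) (m∸[m∸n]≡n i≤n)) ⟩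
    sumToℕ n (λ i → C i k)              ≡⟨ hockey-stick n k ⟩
    C (suc n) (suc k)                   ∎
  hockey-stick-from zero    (suc h) k rewrite 0∸n≡0 h = refl
  hockey-stick-from (suc n) (suc h) k = begin
    sumToℕ (suc n) (λ i → 𝟙 (suc h ≤ᵇ i) * C (suc n ∸ i) k)
      ≡⟨ sum-unshift n _ ⟩
    sumToℕ n (λ i → 𝟙 (suc h ≤ᵇ suc i) * C (n ∸ i) k)
      ≡⟨ sum-cong n (λ i _ → cong (λ b → 𝟙 b * C (n ∸ i) k) (s≤ᵇs h i)) ⟩
    sumToℕ n (λ i → 𝟙 (h ≤ᵇ i) * C (n ∸ i) k)
      ≡⟨ hockey-stick-from n h k ⟩
    C (suc n ∸ h) (suc k)
      ∎

  -- F : Coeffs stands for Σ F n j xⁿ/n! yʲ, and L = x + y(eˣ − 1 − x). The coefficient of xᶜ/c!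
  -- in L is 0, 1 or y according as c = 0, 1 or c ≥ 2; coefL c F is F times that coefficient,
  -- mulDL o F is F times the o-th x-derivative of L, and powL m stands for Lᵐ.
  Coeffs : Set
  Coeffs = ℕ → ℕ → ℕ

  coefL : ℕ → Coeffs → Coeffs
  coefL zero          F n j       = 0
  coefL (suc zero)    F n j       = F n j
  coefL (suc (suc _)) F n zero    = 0
  coefL (suc (suc _)) F n (suc j) = F n j

  mulDL : ℕ → Coeffs → Coeffs
  mulDL o F n j = sumToℕ n (λ i → C n i * coefL (o + i) F (n ∸ i) j)

  mulL mulL′ : Coeffs → Coeffs
  mulL  = mulDL 0
  mulL′ = mulDL 1

  ∂ : Coeffs → Coeffs
  ∂ F n = F (suc n)

  powL : ℕ → Coeffs
  powL zero    zero    zero    = 1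
  powL zero    zero    (suc j) = 0
  powL zero    (suc n) j       = 0
  powL (suc m) n       j       = mulL (powL m) n j

  coefL-mulDL : ∀ c o F n j → coefL c (mulDL o F) n j ≡ sumToℕ n (λ i → C n i * coefL c (coefL (o + i) F) (n ∸ i) j)
  coefL-mulDL zero          o F n j       = sym (sum-vanishes n (λ i _ → *-zeroʳ (C n i)))
  coefL-mulDL (suc zero)    o F n j       = refl
  coefL-mulDL (suc (suc c)) o F n zero    = sym (sum-vanishes n (λ i _ → *-zeroʳ (C n i)))
  coefL-mulDL (suc (suc c)) o F n (suc j) = refl

  coefL-comm : ∀ c d F n j → coefL c (coefL d F) n j ≡ coefL d (coefL c F) n j
  coefL-comm zero          zero          F n j             = refl
  coefL-comm zero          (suc zero)    F n j             = refl
  coefL-comm zero          (suc (suc d)) F n zero          = refl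
  coefL-comm zero          (suc (suc d)) F n (suc j)       = refl
  coefL-comm (suc zero)    zero          F n j             = refl
  coefL-comm (suc zero)    (suc zero)    F n j             = refl
  coefL-comm (suc zero)    (suc (suc d)) F n zero          = refl
  coefL-comm (suc zero)    (suc (suc d)) F n (suc j)       = refl
  coefL-comm (suc (suc c)) zero          F n zero          = refl
  coefL-comm (suc (suc c)) zero          F n (suc j)       = refl
  coefL-comm (suc (suc c)) (suc zero)    F n zero          = refl
  coefL-comm (suc (suc c)) (suc zero)    F n (suc j)       = refl
  coefL-comm (suc (suc c)) (suc (suc d)) F n zero          = refl
  coefL-comm (suc (suc c)) (suc (suc d)) F n (suc zero)    = refl
  coefL-comm (suc (suc c)) (suc (suc d)) F n (suc (suc j)) = refl

  coefL-cong : ∀ c {F G : Coeffs} n j → (∀ k → F n k ≡ G n k) → coefL c F n j ≡ coefL c G n j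
  coefL-cong zero          n j       F≗G = refl
  coefL-cong (suc zero)    n j       F≗G = F≗G j
  coefL-cong (suc (suc c)) n zero    F≗G = refl
  coefL-cong (suc (suc c)) n (suc j) F≗G = F≗G j

  coefL-scale : ∀ c a F n j → coefL c (λ m k → a * F m k) n j ≡ a * coefL c F n j
  coefL-scale zero          a F n j       = sym (*-zeroʳ a)
  coefL-scale (suc zero)    a F n j       = refl
  coefL-scale (suc (suc c)) a F n zero    = sym (*-zeroʳ a)
  coefL-scale (suc (suc c)) a F n (suc j) = refl

  coefL-∂ : ∀ c F n j → coefL c (∂ F) n j ≡ coefL c F (suc n) j
  coefL-∂ zero          F n j       = refl
  coefL-∂ (suc zero)    F n j       = refl
  coefL-∂ (suc (suc c)) F n zero    = refl
  coefL-∂ (suc (suc c)) F n (suc j) = refl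

  mulDL-cong : ∀ o {F G : Coeffs} n j → (∀ m k → m ≤ n → F m k ≡ G m k) → mulDL o F n j ≡ mulDL o G n j
  mulDL-cong o n j F≗G = sum-cong n (λ i _ → cong (C n i *_) (coefL-cong (o + i) (n ∸ i) j (λ k → F≗G (n ∸ i) k (m∸n≤m n i))))

  mulDL-scale : ∀ o a F n j → mulDL o (λ m k → a * F m k) n j ≡ a * mulDL o F n j
  mulDL-scale o a F n j = begin
    sumToℕ n (λ i → C n i * coefL (o + i) (λ m k → a * F m k) (n ∸ i) j)
      ≡⟨ sum-cong n (λ i _ → cong (C n i *_) (coefL-scale (o + i) a F (n ∸ i) j)) ⟩
    sumToℕ n (λ i → C n i * (a * coefL (o + i) F (n ∸ i) j))
      ≡⟨ sum-cong n (λ i _ → x∙yz≈y∙xz (C n i) a _) ⟩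
    sumToℕ n (λ i → a * (C n i * coefL (o + i) F (n ∸ i) j))              ≡⟨ *-distribˡ-sum n a _ ⟨
    a * sumToℕ n (λ i → C n i * coefL (o + i) F (n ∸ i) j)
      ∎
    where open CommutativeSemigroupProperties *-commutativeSemigroup using (x∙yz≈y∙xz)

  mulDL-∂ : ∀ o F n j →
    mulDL o (∂ F) n j ≡ coefL o F (suc n) j + sumToℕ n (λ i → C n (suc i) * coefL (o + suc i) F (n ∸ i) j)
  mulDL-∂ o F n j = begin
    sumToℕ n (λ i → C n i * coefL (o + i) (∂ F) (n ∸ i) j)
      ≡⟨ sum-unshift-within n _ (cong (_* coefL (o + suc n) (∂ F) (n ∸ suc n) j) (C-vanishes (n<1+n n))) ⟩
    C n 0 * coefL (o + 0) (∂ F) (n ∸ 0) j + sumToℕ n (λ i → C n (suc i) * coefL (o + suc i) (∂ F) (n ∸ suc i) j)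
      ≡⟨ cong₂ _+_ first-term (sum-cong n other-terms) ⟩
    coefL o F (suc n) j + sumToℕ n (λ i → C n (suc i) * coefL (o + suc i) F (n ∸ i) j)
      ∎
    where
    first-term : C n 0 * coefL (o + 0) (∂ F) (n ∸ 0) j ≡ coefL o F (suc n) j
    first-term rewrite C-zeroʳ n | +-identityʳ o = trans (+-identityʳ _) (coefL-∂ o F n j)
    other-terms : ∀ i → i ≤ n → C n (suc i) * coefL (o + suc i) (∂ F) (n ∸ suc i) j
      ≡ C n (suc i) * coefL (o + suc i) F (n ∸ i) j
    other-terms i _ with suc i ≤? n
    ... | yes 1+i≤n rewrite coefL-∂ (o + suc i) F (n ∸ suc i) j | +-∸-assoc 1 1+i≤n = refl
    ... | no 1+i≰n rewrite C-vanishes (≰⇒> 1+i≰n) = refl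

  mulL′-unshift : ∀ F n j → mulL′ F n j ≡ F n j + sumToℕ n (λ i → C n (suc i) * coefL (2 + i) F (n ∸ suc i) j)
  mulL′-unshift F n j = begin
    sumToℕ n (λ i → C n i * coefL (suc i) F (n ∸ i) j)
      ≡⟨ sum-unshift-within n _ (cong (_* coefL (2 + n) F (n ∸ suc n) j) (C-vanishes (n<1+n n))) ⟩
    C n 0 * F n j + sumToℕ n (λ i → C n (suc i) * coefL (2 + i) F (n ∸ suc i) j)
      ≡⟨ cong (_+ sumToℕ n (λ i → C n (suc i) * coefL (2 + i) F (n ∸ suc i) j)) (trans (cong (_* F n j) (C-zeroʳ n)) (*-identityˡ (F n j))) ⟩
    F n j + sumToℕ n (λ i → C n (suc i) * coefL (2 + i) F (n ∸ suc i) j)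
      ∎

  mulDL-leibniz : ∀ o F n j → mulDL o F (suc n) j ≡ mulDL (suc o) F n j + mulDL o (∂ F) n j
  mulDL-leibniz o F n j = begin
    sumToℕ (suc n) (λ i → C (suc n) i * coefL (o + i) F (suc n ∸ i) j)
      ≡⟨ sum-unshift n _ ⟩
    1 * coefL (o + 0) F (suc n) j + sumToℕ n (λ i → (C n i + C n (suc i)) * t i)
      ≡⟨ cong₂ _+_ (trans (*-identityˡ _) (cong (λ c → coefL c F (suc n) j) (+-identityʳ o)))
                   (trans (sum-cong n (λ i _ → *-distribʳ-+ (t i) (C n i) (C n (suc i)))) (sum-distrib-+ n _ _)) ⟩
    t₀ + (sumToℕ n (λ i → C n i * t i) + rest)
      ≡⟨ x∙yz≈y∙xz t₀ (sumToℕ n (λ i → C n i * t i)) rest ⟩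
    sumToℕ n (λ i → C n i * t i) + (t₀ + rest)
      ≡⟨ cong₂ _+_ (sum-cong n (λ i _ → cong (λ c → C n i * coefL c F (n ∸ i) j) (+-suc o i))) (sym (mulDL-∂ o F n j)) ⟩
    mulDL (suc o) F n j + mulDL o (∂ F) n j
      ∎
    where
    open CommutativeSemigroupProperties +-commutativeSemigroup using (x∙yz≈y∙xz)
    t : ℕ → ℕ
    t i = coefL (o + suc i) F (n ∸ i) j
    t₀ rest : ℕ
    t₀ = coefL o F (suc n) j
    rest = sumToℕ n (λ i → C n (suc i) * t i)

  private
    mulDL²-term : ℕ → ℕ → Coeffs → ℕ → ℕ → ℕ → ℕ → ℕ
    mulDL²-term o p F n j i k = C n i * (C (n ∸ i) k * coefL (o + i) (coefL (p + k) F) (n ∸ i ∸ k) j)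

  mulDL-mulDL : ∀ o p F n j → mulDL o (mulDL p F) n j ≡ sumToℕ n (λ i → sumToℕ n (mulDL²-term o p F n j i))
  mulDL-mulDL o p F n j = sum-cong n λ i i≤n → begin
    C n i * coefL (o + i) (mulDL p F) (n ∸ i) j
      ≡⟨ cong (C n i *_) (coefL-mulDL (o + i) p F (n ∸ i) j) ⟩
    C n i * sumToℕ (n ∸ i) (λ k → C (n ∸ i) k * term i k)
      ≡⟨ cong (C n i *_) (sum-extend (n ∸ i) n (m∸n≤m n i) (λ k n∸i<k → cong (_* term i k) (C-vanishes n∸i<k))) ⟨
    C n i * sumToℕ n (λ k → C (n ∸ i) k * term i k)
      ≡⟨ *-distribˡ-sum n (C n i) _ ⟩
    sumToℕ n (mulDL²-term o p F n j i)
      ∎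
    where
    term : ℕ → ℕ → ℕ
    term i k = coefL (o + i) (coefL (p + k) F) (n ∸ i ∸ k) j

  mulDL²-term-sym : ∀ o p F n j i k → mulDL²-term o p F n j i k ≡ mulDL²-term p o F n j k i
  mulDL²-term-sym o p F n j i k = begin
    C n i * (C (n ∸ i) k * coefL (o + i) (coefL (p + k) F) (n ∸ i ∸ k) j)
      ≡⟨ *-assoc (C n i) _ _ ⟨
    C n i * C (n ∸ i) k * coefL (o + i) (coefL (p + k) F) (n ∸ i ∸ k) j
      ≡⟨ cong₂ _*_ (C*C-comm n i k) (coefL-comm (o + i) (p + k) F (n ∸ i ∸ k) j) ⟩
    C n k * C (n ∸ k) i * coefL (p + k) (coefL (o + i) F) (n ∸ i ∸ k) j
      ≡⟨ cong (λ m → C n k * C (n ∸ k) i * coefL (p + k) (coefL (o + i) F) m j) (m∸n∸o≡m∸o∸n n i k) ⟩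
    C n k * C (n ∸ k) i * coefL (p + k) (coefL (o + i) F) (n ∸ k ∸ i) j
      ≡⟨ *-assoc (C n k) _ _ ⟩
    C n k * (C (n ∸ k) i * coefL (p + k) (coefL (o + i) F) (n ∸ k ∸ i) j)
      ∎

  mulDL-comm : ∀ o p F n j → mulDL o (mulDL p F) n j ≡ mulDL p (mulDL o F) n j
  mulDL-comm o p F n j = begin
    mulDL o (mulDL p F) n j
      ≡⟨ mulDL-mulDL o p F n j ⟩
    sumToℕ n (λ i → sumToℕ n (mulDL²-term o p F n j i))
      ≡⟨ sum-swap n n _ ⟩
    sumToℕ n (λ k → sumToℕ n (λ i → mulDL²-term o p F n j i k))
      ≡⟨ sum-cong n (λ k _ → sum-cong n (λ i _ → mulDL²-term-sym o p F n j i k)) ⟩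
    sumToℕ n (λ k → sumToℕ n (mulDL²-term p o F n j k))              ≡⟨ mulDL-mulDL p o F n j ⟨
    mulDL p (mulDL o F) n j
      ∎

  powL-derivative : ∀ m n j → powL (suc m) (suc n) j ≡ suc m * mulL′ (powL m) n j
  powL-derivative zero n j = begin
    mulL (powL 0) (suc n) j
      ≡⟨ mulDL-leibniz 0 (powL 0) n j ⟩
    mulL′ (powL 0) n j + mulL (∂ (powL 0)) n j
      ≡⟨ cong (mulL′ (powL 0) n j +_) (sum-vanishes n (λ i _ → trans (cong (C n i *_) (coefL-zero i (n ∸ i) j)) (*-zeroʳ (C n i)))) ⟩
    mulL′ (powL 0) n j + 0
      ∎
    where
    coefL-zero : ∀ c m k → coefL c (∂ (powL 0)) m k ≡ 0
    coefL-zero zero          m k       = refl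
    coefL-zero (suc zero)    m k       = refl
    coefL-zero (suc (suc c)) m zero    = refl
    coefL-zero (suc (suc c)) m (suc k) = refl
  powL-derivative (suc m) n j = begin
    mulL (powL (suc m)) (suc n) j
      ≡⟨ mulDL-leibniz 0 (powL (suc m)) n j ⟩
    mulL′ (powL (suc m)) n j + mulL (∂ (powL (suc m))) n j
      ≡⟨ cong (mulL′ (powL (suc m)) n j +_) (mulDL-cong 0 n j (λ k l _ → powL-derivative m k l)) ⟩
    mulL′ (powL (suc m)) n j + mulL (λ k l → suc m * mulL′ (powL m) k l) n j
      ≡⟨ cong (mulL′ (powL (suc m)) n j +_) (mulDL-scale 0 (suc m) (mulL′ (powL m)) n j) ⟩
    mulL′ (powL (suc m)) n j + suc m * mulL (mulL′ (powL m)) n j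
      ≡⟨ cong (λ t → mulL′ (powL (suc m)) n j + suc m * t) (mulDL-comm 0 1 (powL m) n j) ⟩
    mulL′ (powL (suc m)) n j + suc m * mulL′ (powL (suc m)) n j
      ∎

  runCount : List ℕ → ℕ
  runCount []           = 0
  runCount (x ∷ [])     = 1
  runCount (x ∷ y ∷ ys) = (if x <ᵇ y then 0 else 1) + runCount (y ∷ ys)

  runMins : List ℕ → List ℕ
  runMins []           = []
  runMins (x ∷ [])     = x ∷ []
  runMins (x ∷ y ∷ ys) = if x <ᵇ y then x ∷ drop 1 (runMins (y ∷ ys)) else x ∷ runMins (y ∷ ys)

  runs-∷ : ∀ y ys → ∃₂ λ r rs → runs (y ∷ ys) ≡ (y ∷ r) ∷ rs
  runs-∷ y []       = [] , [] , refl
  runs-∷ y (z ∷ zs) with runs-∷ z zs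
  ... | r , rs , eq rewrite eq with y <ᵇ z
  ... | true  = z ∷ r , rs , refl
  ... | false = [] , (z ∷ r) ∷ rs , refl

  nRuns≡runCount : ∀ w → nRuns w ≡ runCount w
  nRuns≡runCount []           = refl
  nRuns≡runCount (x ∷ [])     = refl
  nRuns≡runCount (x ∷ y ∷ ys) with runs-∷ y ys | nRuns≡runCount (y ∷ ys)
  ... | r , rs , eq | ih rewrite eq | sym ih with x <ᵇ y
  ... | true  = refl
  ... | false = refl

  runMinima≡runMins : ∀ w → runMinima w ≡ runMins w
  runMinima≡runMins []           = refl
  runMinima≡runMins (x ∷ [])     = refl
  runMinima≡runMins (x ∷ y ∷ ys) with runs-∷ y ys | runMinima≡runMins (y ∷ ys)
  ... | r , rs , eq | ih rewrite eq with x <ᵇ y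
  ... | true  = cong (λ ms → x ∷ drop 1 ms) ih
  ... | false = cong (x ∷_) ih

  shift : ℕ → ℕ → ℕ
  shift h y = if y <ᵇ h then y else suc y

  shift-<ᵇ : ∀ h a b → (shift h a <ᵇ shift h b) ≡ (a <ᵇ b)
  shift-<ᵇ h a b with a <ᵇ h | <ᵇ-reflects-< a h | b <ᵇ h | <ᵇ-reflects-< b h
  ... | true  | ofʸ a<h | true  | _       = refl
  ... | true  | ofʸ a<h | false | ofⁿ b≮h = trans (<ᵇ-true (m<n⇒m<1+n a<b)) (sym (<ᵇ-true a<b))
    where
    a<b : a < b
    a<b = <-≤-trans a<h (≮⇒≥ b≮h)
  ... | false | ofⁿ a≮h | true  | ofʸ b<h = trans (<ᵇ-false (m≤n⇒m≤1+n b≤a)) (sym (<ᵇ-false b≤a))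
    where
    b≤a : b ≤ a
    b≤a = <⇒≤ (<-≤-trans b<h (≮⇒≥ a≮h))
  ... | false | _       | false | _       = refl

  shift-≡ᵇ : ∀ h a b → (shift h a ≡ᵇ shift h b) ≡ (a ≡ᵇ b)
  shift-≡ᵇ h a b with a <ᵇ h | <ᵇ-reflects-< a h | b <ᵇ h | <ᵇ-reflects-< b h
  ... | true  | ofʸ a<h | true  | _       = refl
  ... | true  | ofʸ a<h | false | ofⁿ b≮h = trans (≡ᵇ-false (<⇒≢ (m<n⇒m<1+n a<b))) (sym (≡ᵇ-false (<⇒≢ a<b)))
    where
    a<b : a < b
    a<b = <-≤-trans a<h (≮⇒≥ b≮h)
  ... | false | ofⁿ a≮h | true  | ofʸ b<h = trans (≡ᵇ-false (≢-sym (<⇒≢ (m<n⇒m<1+n b<a)))) (sym (≡ᵇ-false (≢-sym (<⇒≢ b<a))))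
    where
    b<a : b < a
    b<a = <-≤-trans b<h (≮⇒≥ a≮h)
  ... | false | _       | false | _       = refl

  shift-≢ : ∀ h y → (h ≡ᵇ shift h y) ≡ false
  shift-≢ h y with y <ᵇ h | <ᵇ-reflects-< y h
  ... | true  | ofʸ y<h = ≡ᵇ-false (≢-sym (<⇒≢ y<h))
  ... | false | ofⁿ y≮h = ≡ᵇ-false (<⇒≢ (s≤s (≮⇒≥ y≮h)))

  shift-suc : ∀ h y → shift (suc h) (suc y) ≡ suc (shift h y)
  shift-suc h y with y <ᵇ h
  ... | true  = refl
  ... | false = refl

  module OrderEmbedding (f : ℕ → ℕ) (f-<ᵇ : ∀ a b → (f a <ᵇ f b) ≡ (a <ᵇ b)) where

    runCount-map : ∀ w → runCount (map f w) ≡ runCount w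
    runCount-map []           = refl
    runCount-map (x ∷ [])     = refl
    runCount-map (x ∷ y ∷ ys) rewrite runCount-map (y ∷ ys) | f-<ᵇ x y = refl

    runMins-map : ∀ w → runMins (map f w) ≡ map f (runMins w)
    runMins-map []           = refl
    runMins-map (x ∷ [])     = refl
    runMins-map (x ∷ y ∷ ys) rewrite runMins-map (y ∷ ys) | f-<ᵇ x y with x <ᵇ y
    ... | true  = cong (f x ∷_) (drop-map 1 (runMins (y ∷ ys)))
    ... | false = refl

    strictlyIncreasing-map : ∀ w → strictlyIncreasing (map f w) ≡ strictlyIncreasing w
    strictlyIncreasing-map []          = refl
    strictlyIncreasing-map (x ∷ [])    = refl
    strictlyIncreasing-map (x ∷ y ∷ w) rewrite strictlyIncreasing-map (y ∷ w) | f-<ᵇ x y = refl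

    all-<ᵇ-map : ∀ x w → all (f x <ᵇ_) (map f w) ≡ all (x <ᵇ_) w
    all-<ᵇ-map x []      = refl
    all-<ᵇ-map x (y ∷ w) rewrite f-<ᵇ x y | all-<ᵇ-map x w = refl

    nRLmin-map : ∀ w → nRLmin (map f w) ≡ nRLmin w
    nRLmin-map []      = refl
    nRLmin-map (x ∷ w) rewrite all-<ᵇ-map x w | nRLmin-map w = refl

  module Shift (h : ℕ) = OrderEmbedding (shift h) (shift-<ᵇ h)

  sumBy : {X : Set} → (X → ℕ) → List X → ℕ
  sumBy w []       = 0
  sumBy w (x ∷ xs) = w x + sumBy w xs

  module _ {X : Set} where

    sumBy-cong : ∀ {w w′ : X → ℕ} xs → (∀ x → w x ≡ w′ x) → sumBy w xs ≡ sumBy w′ xs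
    sumBy-cong []       w≗w′ = refl
    sumBy-cong (x ∷ xs) w≗w′ = cong₂ _+_ (w≗w′ x) (sumBy-cong xs w≗w′)

    sumBy-vanishes : ∀ {w : X → ℕ} xs → (∀ x → w x ≡ 0) → sumBy w xs ≡ 0
    sumBy-vanishes []       w≗0 = refl
    sumBy-vanishes (x ∷ xs) w≗0 rewrite w≗0 x = sumBy-vanishes xs w≗0

    sumBy-++ : ∀ (w : X → ℕ) xs ys → sumBy w (xs ++ ys) ≡ sumBy w xs + sumBy w ys
    sumBy-++ w []       ys = refl
    sumBy-++ w (x ∷ xs) ys rewrite sumBy-++ w xs ys = sym (+-assoc (w x) _ _)

    sumBy-map : ∀ {Y : Set} (w : X → ℕ) (g : Y → X) ys → sumBy w (map g ys) ≡ sumBy (w ∘ g) ys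
    sumBy-map w g []       = refl
    sumBy-map w g (y ∷ ys) = cong (w (g y) +_) (sumBy-map w g ys)

    sumBy-concatMap : ∀ {Y : Set} (w : X → ℕ) (g : Y → List X) ys → sumBy w (concatMap g ys) ≡ sumBy (sumBy w ∘ g) ys
    sumBy-concatMap w g []       = refl
    sumBy-concatMap w g (y ∷ ys) = trans (sumBy-++ w (g y) (concatMap g ys)) (cong (sumBy w (g y) +_) (sumBy-concatMap w g ys))

    sumBy-filterᵇ : ∀ (w : X → ℕ) p xs → sumBy w (filterᵇ p xs) ≡ sumBy (λ x → 𝟙 (p x) * w x) xs
    sumBy-filterᵇ w p []       = refl
    sumBy-filterᵇ w p (x ∷ xs) with p x
    ... | true  = cong₂ _+_ (sym (*-identityˡ (w x))) (sumBy-filterᵇ w p xs)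
    ... | false = sumBy-filterᵇ w p xs

    length-filterᵇ : ∀ (p : X → Bool) xs → length (filterᵇ p xs) ≡ sumBy (𝟙 ∘ p) xs
    length-filterᵇ p []       = refl
    length-filterᵇ p (x ∷ xs) with p x
    ... | true  = cong suc (length-filterᵇ p xs)
    ... | false = length-filterᵇ p xs

    sumBy-+ : ∀ (v w : X → ℕ) xs → sumBy (λ x → v x + w x) xs ≡ sumBy v xs + sumBy w xs
    sumBy-+ v w []       = refl
    sumBy-+ v w (x ∷ xs) rewrite sumBy-+ v w xs = +-interchange (v x) (w x) (sumBy v xs) (sumBy w xs)
      where open CommutativeSemigroupProperties +-commutativeSemigroup renaming (interchange to +-interchange)

    *-distribˡ-sumBy : ∀ c (w : X → ℕ) xs → c * sumBy w xs ≡ sumBy (λ x → c * w x) xs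
    *-distribˡ-sumBy c w []       = *-zeroʳ c
    *-distribˡ-sumBy c w (x ∷ xs) = trans (*-distribˡ-+ c (w x) (sumBy w xs)) (cong (c * w x +_) (*-distribˡ-sumBy c w xs))

    sumBy-sumToℕ : ∀ n (w : ℕ → X → ℕ) xs → sumBy (λ x → sumToℕ n (λ i → w i x)) xs ≡ sumToℕ n (λ i → sumBy (w i) xs)
    sumBy-sumToℕ n w []       = sym (sum-vanishes n (λ _ _ → refl))
    sumBy-sumToℕ n w (x ∷ xs) rewrite sumBy-sumToℕ n w xs = sym (sum-distrib-+ n (λ i → w i x) (λ i → sumBy (w i) xs))

  sumBelow : ℕ → (ℕ → ℕ) → ℕ
  sumBelow zero    f = 0
  sumBelow (suc n) f = f 0 + sumBelow n (f ∘ suc)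

  sumBelow-cong : ∀ n {f g : ℕ → ℕ} → (∀ i → i < n → f i ≡ g i) → sumBelow n f ≡ sumBelow n g
  sumBelow-cong zero    f≗g = refl
  sumBelow-cong (suc n) f≗g = cong₂ _+_ (f≗g 0 z<s) (sumBelow-cong n (λ i i<n → f≗g (suc i) (s<s i<n)))

  sumBelow-suc : ∀ n f → sumBelow (suc n) f ≡ sumToℕ n f
  sumBelow-suc zero    f = +-identityʳ (f 0)
  sumBelow-suc (suc n) f = trans (cong (f 0 +_) (sumBelow-suc n (f ∘ suc))) (sym (sum-unshift n f))

  sumBy-applyUpTo : ∀ (w : ℕ → ℕ) g n → sumBy w (applyUpTo g n) ≡ sumBelow n (w ∘ g)
  sumBy-applyUpTo w g zero    = refl
  sumBy-applyUpTo w g (suc n) = cong (w (g 0) +_) (sumBy-applyUpTo w (g ∘ suc) n)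

  -- prepend h v has first letter h and is followed by a word order-isomorphic to v; every
  -- permutation of [n+1] arises exactly once in this way from a permutation of [n].
  prepend : ℕ → List ℕ → List ℕ
  prepend h v = h ∷ map (shift h) v

  permsByFirst : ℕ → List (List ℕ)
  permsByFirst zero    = [] ∷ []
  permsByFirst (suc n) = concatMap (λ h → map (prepend h) (permsByFirst n)) (applyUpTo suc (suc n))

  sumBy-permsByFirst : ∀ n w → sumBy w (permsByFirst (suc n)) ≡ sumToℕ n (λ i → sumBy (w ∘ prepend (suc i)) (permsByFirst n))
  sumBy-permsByFirst n w = begin
    sumBy w (permsByFirst (suc n))
      ≡⟨ sumBy-concatMap w (λ h → map (prepend h) (permsByFirst n)) (applyUpTo suc (suc n)) ⟩
    sumBy (λ h → sumBy w (map (prepend h) (permsByFirst n))) (applyUpTo suc (suc n))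
      ≡⟨ sumBy-applyUpTo _ suc (suc n) ⟩
    sumBelow (suc n) (λ i → sumBy w (map (prepend (suc i)) (permsByFirst n)))
      ≡⟨ sumBelow-suc n _ ⟩
    sumToℕ n (λ i → sumBy w (map (prepend (suc i)) (permsByFirst n)))
      ≡⟨ sum-cong n (λ i _ → sumBy-map w (prepend (suc i)) (permsByFirst n)) ⟩
    sumToℕ n (λ i → sumBy (w ∘ prepend (suc i)) (permsByFirst n))
      ∎

  Admissible : ℕ → List ℕ → Set
  Admissible n v = All (λ y → 1 ≤ y × y ≤ n) v × (1 ≤ n → 1 ∈ v)

  admissible-prepend : ∀ n h v → 1 ≤ h → h ≤ suc n → Admissible n v → Admissible (suc n) (prepend h v)
  admissible-prepend n h v 1≤h h≤1+n (inRange , 1∈v) = ((1≤h , h≤1+n) ∷ All.map⁺ (All.map shift-inRange inRange)) , λ _ → 1∈prepend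
    where
    shift-inRange : ∀ {y} → 1 ≤ y × y ≤ n → 1 ≤ shift h y × shift h y ≤ suc n
    shift-inRange {y} (1≤y , y≤n) with y <ᵇ h
    ... | true  = 1≤y , m≤n⇒m≤1+n y≤n
    ... | false = s≤s z≤n , s≤s y≤n
    1∈prepend : 1 ∈ prepend h v
    1∈prepend with h ≟ 1
    ... | yes refl = here refl
    ... | no h≢1 = there (subst (_∈ map (shift h) v) (cong (if_then 1 else 2) (<ᵇ-true 1<h)) (∈-map⁺ (shift h) (1∈v 1≤n)))
      where
      1<h : 1 < h
      1<h = ≤∧≢⇒< 1≤h (≢-sym h≢1)
      1≤n : 1 ≤ n
      1≤n = ≤-pred (≤-trans 1<h h≤1+n)

  sumBy-permsByFirst-cong : ∀ n (w w′ : List ℕ → ℕ) → (∀ v → Admissible n v → w v ≡ w′ v) →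
    sumBy w (permsByFirst n) ≡ sumBy w′ (permsByFirst n)
  sumBy-permsByFirst-cong zero    w w′ w≗w′ = cong (_+ 0) (w≗w′ [] ([] , λ ()))
  sumBy-permsByFirst-cong (suc n) w w′ w≗w′ = begin
    sumBy w (permsByFirst (suc n))
      ≡⟨ sumBy-permsByFirst n w ⟩
    sumToℕ n (λ i → sumBy (w ∘ prepend (suc i)) (permsByFirst n))
      ≡⟨ sum-cong n (λ i i≤n → sumBy-permsByFirst-cong n _ _ (λ v adm →
           w≗w′ (prepend (suc i) v) (admissible-prepend n (suc i) v (s≤s z≤n) (s≤s i≤n) adm))) ⟩
    sumToℕ n (λ i → sumBy (w′ ∘ prepend (suc i)) (permsByFirst n))
      ≡⟨ sumBy-permsByFirst n w′ ⟨
    sumBy w′ (permsByFirst (suc n))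
      ∎

  sumBy-prepend-cong : ∀ n (w w′ : List ℕ → ℕ) →
    (∀ i v → i ≤ n → Admissible n v → w (prepend (suc i) v) ≡ w′ (prepend (suc i) v)) →
    sumBy w (permsByFirst (suc n)) ≡ sumBy w′ (permsByFirst (suc n))
  sumBy-prepend-cong n w w′ w≗w′ = begin
    sumBy w (permsByFirst (suc n))
      ≡⟨ sumBy-permsByFirst n w ⟩
    sumToℕ n (λ i → sumBy (w ∘ prepend (suc i)) (permsByFirst n))
      ≡⟨ sum-cong n (λ i i≤n → sumBy-permsByFirst-cong n _ _ (λ v → w≗w′ i v i≤n)) ⟩
    sumToℕ n (λ i → sumBy (w′ ∘ prepend (suc i)) (permsByFirst n))
      ≡⟨ sumBy-permsByFirst n w′ ⟨
    sumBy w′ (permsByFirst (suc n))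
      ∎

  sumBy-permsByFirst-vanishes : ∀ n (w : List ℕ → ℕ) → (∀ i v → w (prepend (suc i) v) ≡ 0) →
    sumBy w (permsByFirst (suc n)) ≡ 0
  sumBy-permsByFirst-vanishes n w w≗0 =
    trans (sumBy-permsByFirst n w) (sum-vanishes n (λ i _ → sumBy-vanishes (permsByFirst n) (w≗0 i)))

  admissible-∷ : ∀ n v → Admissible (suc n) v → ∃₂ λ y ys → v ≡ y ∷ ys
  admissible-∷ n []       (_ , 1∈v) with 1∈v (s≤s z≤n)
  ... | ()
  admissible-∷ n (y ∷ ys) _ = y , ys , refl

  first : List ℕ → ℕ
  first []      = 0
  first (x ∷ _) = x

  first-inRange : ∀ n v → Admissible (suc n) v → 1 ≤ first v × first v ≤ suc n
  first-inRange n []       (_ , 1∈v) with 1∈v (s≤s z≤n)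
  ... | ()
  first-inRange n (y ∷ ys) (y-inRange ∷ _ , _) = y-inRange

  tailRunSorted : List ℕ → Bool
  tailRunSorted v = strictlyIncreasing (drop 1 (runMins v))

  runSorted≡ : ∀ v → runSorted v ≡ strictlyIncreasing (runMins v)
  runSorted≡ v = cong strictlyIncreasing (runMinima≡runMins v)

  <ᵇ-shift : ∀ h y → (h <ᵇ shift h y) ≡ (h ≤ᵇ y)
  <ᵇ-shift h y with y <ᵇ h | <ᵇ-reflects-< y h
  ... | true  | ofʸ y<h = trans (<ᵇ-false (<⇒≤ y<h)) (sym (≤ᵇ-false y<h))
  ... | false | ofⁿ y≮h = trans (<ᵇ-true (s≤s (≮⇒≥ y≮h))) (sym (≤ᵇ-true (≮⇒≥ y≮h)))

  runCount-prepend : ∀ h y ys → runCount (prepend h (y ∷ ys)) ≡ (if h ≤ᵇ y then 0 else 1) + runCount (y ∷ ys)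
  runCount-prepend h y ys rewrite <ᵇ-shift h y | Shift.runCount-map h (y ∷ ys) = refl

  runMins-prepend : ∀ h y ys → runMins (prepend h (y ∷ ys)) ≡
    (if h ≤ᵇ y then h ∷ drop 1 (map (shift h) (runMins (y ∷ ys))) else h ∷ map (shift h) (runMins (y ∷ ys)))
  runMins-prepend h y ys rewrite <ᵇ-shift h y | Shift.runMins-map h (y ∷ ys) = refl

  tailRunSorted-prepend : ∀ h y ys → tailRunSorted (prepend h (y ∷ ys))
    ≡ (if h ≤ᵇ y then tailRunSorted (y ∷ ys) else runSorted (y ∷ ys))
  tailRunSorted-prepend h y ys rewrite runMins-prepend h y ys | runSorted≡ (y ∷ ys) with h ≤ᵇ y
  ... | true  = trans (cong strictlyIncreasing (drop-map 1 (runMins (y ∷ ys)))) (Shift.strictlyIncreasing-map h (drop 1 (runMins (y ∷ ys))))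
  ... | false = Shift.strictlyIncreasing-map h (runMins (y ∷ ys))

  all-false : ∀ (p : ℕ → Bool) {x} xs → x ∈ xs → p x ≡ false → all p xs ≡ false
  all-false p (y ∷ xs) (here refl) px≡false rewrite px≡false = refl
  all-false p (y ∷ xs) (there x∈xs) px≡false rewrite all-false p xs x∈xs px≡false = ∧-zeroʳ (p y)

  all-<ᵇ-shift : ∀ n h v → Admissible n v → 1 ≤ n → 1 ≤ h → all (h <ᵇ_) (map (shift h) v) ≡ (h ≡ᵇ 1)
  all-<ᵇ-shift n (suc zero) v (inRange , _) _ _ = go v inRange
    where
    go : ∀ v → All (λ y → 1 ≤ y × y ≤ n) v → all (1 <ᵇ_) (map (shift 1) v) ≡ true
    go []          []       = refl
    go (suc y ∷ v) (_ ∷ ys) = go v ys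
  all-<ᵇ-shift n (suc (suc h)) v (_ , 1∈v) 1≤n _ = all-false _ (map (shift (2 + h)) v) (∈-map⁺ (shift (2 + h)) (1∈v 1≤n)) refl

  nRLmin-prepend : ∀ n h v → Admissible n v → 1 ≤ n → 1 ≤ h → nRLmin (prepend h v) ≡ 𝟙 (h ≡ᵇ 1) + nRLmin v
  nRLmin-prepend n h v adm 1≤n 1≤h rewrite all-<ᵇ-shift n h v adm 1≤n 1≤h | Shift.nRLmin-map h v = refl

  All-runMins : ∀ {P : ℕ → Set} w → All P w → All P (runMins w)
  All-runMins []           []               = []
  All-runMins (x ∷ [])     (px ∷ [])        = px ∷ []
  All-runMins (x ∷ y ∷ ys) (px ∷ pys) with x <ᵇ y
  ... | true  = px ∷ All.drop⁺ 1 (All-runMins (y ∷ ys) pys)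
  ... | false = px ∷ All-runMins (y ∷ ys) pys

  runMins-∷ : ∀ y ys → ∃ λ ms → runMins (y ∷ ys) ≡ y ∷ ms
  runMins-∷ y []       = [] , refl
  runMins-∷ y (z ∷ zs) with y <ᵇ z
  ... | true  = _ , refl
  ... | false = _ , refl

  1∈runMins : ∀ w → All (1 ≤_) w → 1 ∈ w → 1 ∈ runMins w
  1∈runMins (x ∷ [])     _          1∈w         = 1∈w
  1∈runMins (x ∷ y ∷ ys) _          (here refl) with 1 <ᵇ y
  ... | true  = here refl
  ... | false = here refl
  1∈runMins (x ∷ y ∷ ys) (1≤x ∷ ps) (there 1∈w) with runMins-∷ y ys | 1∈runMins (y ∷ ys) ps 1∈w
  ... | ms , eq | 1∈ms′ with x <ᵇ y | <ᵇ-reflects-< x y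
  ... | false | _       = there 1∈ms′
  ... | true  | ofʸ x<y rewrite eq = there (not-head 1∈ms′)
    where
    not-head : 1 ∈ y ∷ ms → 1 ∈ ms
    not-head (here refl) = ⊥-elim (<-irrefl refl (≤-trans (s≤s 1≤x) x<y))
    not-head (there 1∈ms) = 1∈ms

  strictlyIncreasing-head< : ∀ h xs {z} → strictlyIncreasing (h ∷ xs) ≡ true → z ∈ xs → h < z
  strictlyIncreasing-head< h (x ∷ xs) incr z∈xs with h <ᵇ x | <ᵇ-reflects-< h x
  strictlyIncreasing-head< h (x ∷ xs) incr (here refl)  | true | ofʸ h<x = h<x
  strictlyIncreasing-head< h (x ∷ xs) incr (there z∈xs) | true | ofʸ h<x = <-trans h<x (strictlyIncreasing-head< x xs incr z∈xs)

  runSorted⇒first≡1 : ∀ w → All (1 ≤_) w → 1 ∈ w → runSorted w ≡ true → first w ≡ 1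
  runSorted⇒first≡1 (y ∷ ys) pos@(1≤y ∷ _) 1∈w sorted with runMins-∷ y ys | 1∈runMins (y ∷ ys) pos 1∈w
  ... | ms , eq | 1∈runMins rewrite eq with 1∈runMins
  ... | here refl  = refl
  ... | there 1∈ms = ⊥-elim (<-irrefl refl (≤-trans (s≤s 1≤y) (strictlyIncreasing-head< y ms increasing 1∈ms)))
    where
    increasing : strictlyIncreasing (y ∷ ms) ≡ true
    increasing = trans (cong strictlyIncreasing (sym eq)) (trans (sym (runSorted≡ (y ∷ ys))) sorted)

  strictlyIncreasing-1∷ : ∀ w → All (1 ≤_) w → strictlyIncreasing (1 ∷ map (shift 1) w) ≡ strictlyIncreasing w
  strictlyIncreasing-1∷ []          []      = refl
  strictlyIncreasing-1∷ (suc y ∷ w) (_ ∷ _) = Shift.strictlyIncreasing-map 1 (suc y ∷ w)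

  runSorted-prepend : ∀ n h v → Admissible n v → 1 ≤ n → 1 ≤ h → h ≤ suc n →
    runSorted (prepend h v) ≡ (h ≡ᵇ 1) ∧ tailRunSorted v
  runSorted-prepend n 1 [] (_ , 1∈v) 1≤n _ _ with 1∈v 1≤n
  ... | ()
  runSorted-prepend n 1 (y ∷ ys) (inRange , _) _ _ _ rewrite runSorted≡ (prepend 1 (y ∷ ys)) | runMins-prepend 1 y ys
    | ≤ᵇ-true (proj₁ (All.head inRange)) = begin
    strictlyIncreasing (1 ∷ drop 1 (map (shift 1) (runMins (y ∷ ys))))
      ≡⟨ cong (λ ms → strictlyIncreasing (1 ∷ ms)) (drop-map 1 (runMins (y ∷ ys))) ⟩
    strictlyIncreasing (1 ∷ map (shift 1) (drop 1 (runMins (y ∷ ys))))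
      ≡⟨ strictlyIncreasing-1∷ _ (All.drop⁺ 1 (All-runMins (y ∷ ys) (All.map proj₁ inRange))) ⟩
    tailRunSorted (y ∷ ys)
      ∎
  runSorted-prepend n h@(suc (suc _)) v adm 1≤n 1≤h h≤1+n with runSorted (prepend h v) in sorted
  ... | false = refl
  ... | true with admissible-prepend n h v 1≤h h≤1+n adm
  ...   | inRange′ , 1∈v′ with runSorted⇒first≡1 (prepend h v) (All.map proj₁ inRange′) (1∈v′ (s≤s z≤n)) sorted
  ...     | ()

  sumBelow-delete : ∀ m h (f : ℕ → ℕ) → 1 ≤ h → h ≤ suc m → f h ≡ 0 →
    sumBelow (suc m) (f ∘ suc) ≡ sumBelow m (λ i → f (shift h (suc i)))
  sumBelow-delete m             1             f _ _           fh≡0 = cong (_+ sumBelow m (f ∘ suc ∘ suc)) fh≡0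
  sumBelow-delete zero          (suc (suc h)) f _ (s≤s ())    fh≡0
  sumBelow-delete (suc m)       (suc (suc h)) f _ (s≤s h<1+m) fh≡0 =
    cong (f 1 +_) (trans (sumBelow-delete m (suc h) (f ∘ suc) (s≤s z≤n) h<1+m fh≡0)
                         (sumBelow-cong m (λ i _ → cong f (sym (shift-suc (suc h) (suc i))))))

  avoids : ℕ → List ℕ → Bool
  avoids h w = all (λ y → not (h ≡ᵇ y)) w

  avoids-shift : ∀ h x w → avoids (shift h x) (map (shift h) w) ≡ avoids x w
  avoids-shift h x []      = refl
  avoids-shift h x (y ∷ w) rewrite shift-≡ᵇ h x y | avoids-shift h x w = refl

  sumBy-words-suc : ∀ m n (w : List ℕ → ℕ) → sumBy w (words m (suc n))
    ≡ sumBelow m (λ i → sumBy (w ∘ (suc i ∷_)) (words m n))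
  sumBy-words-suc m n w = begin
    sumBy w (words m (suc n))
      ≡⟨ sumBy-concatMap w (λ x → map (x ∷_) (words m n)) (map suc (upTo m)) ⟩
    sumBy (λ x → sumBy w (map (x ∷_) (words m n))) (map suc (upTo m))
      ≡⟨ cong (sumBy _) (map-applyUpTo id suc m) ⟩
    sumBy (λ x → sumBy w (map (x ∷_) (words m n))) (applyUpTo suc m)
      ≡⟨ sumBy-applyUpTo _ suc m ⟩
    sumBelow m (λ i → sumBy w (map (suc i ∷_) (words m n)))
      ≡⟨ sumBelow-cong m (λ i _ → sumBy-map w (suc i ∷_) (words m n)) ⟩
    sumBelow m (λ i → sumBy (w ∘ (suc i ∷_)) (words m n))
      ∎

  𝟙-∧-* : ∀ a b c → 𝟙 (a ∧ b) * c ≡ 𝟙 a * (𝟙 b * c)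
  𝟙-∧-* true  b c = sym (*-identityˡ (𝟙 b * c))
  𝟙-∧-* false b c = refl

  𝟙-distinct∧avoids-∷ : ∀ h x y c → (h ≡ᵇ x) ≡ false →
    𝟙 (distinct (x ∷ y) ∧ avoids h (x ∷ y)) * c ≡ 𝟙 (distinct y ∧ avoids h y) * (𝟙 (avoids x y) * c)
  𝟙-distinct∧avoids-∷ h x y c h≢x rewrite h≢x | ∧-assoc (avoids x y) (distinct y) (avoids h y) =
    trans (𝟙-∧-* (avoids x y) (distinct y ∧ avoids h y) c) (x∙yz≈y∙xz (𝟙 (avoids x y)) (𝟙 (distinct y ∧ avoids h y)) c)
    where open CommutativeSemigroupProperties *-commutativeSemigroup using (x∙yz≈y∙xz)

  𝟙-distinct-∷-shift : ∀ h x y c →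
    𝟙 (distinct y) * (𝟙 (avoids (shift h x) (map (shift h) y)) * c) ≡ 𝟙 (distinct (x ∷ y)) * c
  𝟙-distinct-∷-shift h x y c rewrite avoids-shift h x y =
    trans (x∙yz≈y∙xz (𝟙 (distinct y)) (𝟙 (avoids x y)) c) (sym (𝟙-∧-* (avoids x y) (distinct y) c))
    where open CommutativeSemigroupProperties *-commutativeSemigroup using (x∙yz≈y∙xz)

  sumBy-words-avoiding : ∀ m n h → 1 ≤ h → h ≤ suc m → ∀ (w : List ℕ → ℕ) →
    sumBy (λ x → 𝟙 (distinct x ∧ avoids h x) * w x) (words (suc m) n)
      ≡ sumBy (λ x → 𝟙 (distinct x) * w (map (shift h) x)) (words m n)
  sumBy-words-avoiding m zero    h _   _     w = refl
  sumBy-words-avoiding m (suc n) h 1≤h h≤1+m w = begin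
    sumBy (λ x → 𝟙 (distinct x ∧ avoids h x) * w x) (words (suc m) (suc n))
      ≡⟨ sumBy-words-suc (suc m) n _ ⟩
    sumBelow (suc m) (f ∘ suc)
      ≡⟨ sumBelow-delete m h f 1≤h h≤1+m f[h]≡0 ⟩
    sumBelow m (λ i → f (shift h (suc i)))
      ≡⟨ sumBelow-cong m (λ i _ → f-shift (suc i)) ⟩
    sumBelow m (λ i → sumBy (λ y → 𝟙 (distinct (suc i ∷ y)) * w (map (shift h) (suc i ∷ y))) (words m n))
      ≡⟨ sumBy-words-suc m n _ ⟨
    sumBy (λ x → 𝟙 (distinct x) * w (map (shift h) x)) (words m (suc n))
      ∎
    where
    f : ℕ → ℕ
    f x = sumBy (λ y → 𝟙 (distinct (x ∷ y) ∧ avoids h (x ∷ y)) * w (x ∷ y)) (words (suc m) n)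
    f[h]≡0 : f h ≡ 0
    f[h]≡0 = sumBy-vanishes (words (suc m) n) λ y → trans
      (cong (λ b → 𝟙 (distinct (h ∷ y) ∧ (not b ∧ avoids h y)) * w (h ∷ y)) (≡ᵇ-refl h))
      (cong (λ b → 𝟙 b * w (h ∷ y)) (∧-zeroʳ (distinct (h ∷ y))))
    f-shift : ∀ x → f (shift h x) ≡ sumBy (λ y → 𝟙 (distinct (x ∷ y)) * w (map (shift h) (x ∷ y))) (words m n)
    f-shift x = begin
      f (shift h x)
        ≡⟨ sumBy-cong (words (suc m) n) (λ y → 𝟙-distinct∧avoids-∷ h (shift h x) y _ (shift-≢ h x)) ⟩
      sumBy (λ y → 𝟙 (distinct y ∧ avoids h y) * (𝟙 (avoids (shift h x) y) * w (shift h x ∷ y))) (words (suc m) n)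
        ≡⟨ sumBy-words-avoiding m n h 1≤h h≤1+m _ ⟩
      sumBy (λ y → 𝟙 (distinct y) * (𝟙 (avoids (shift h x) (map (shift h) y)) * w (shift h x ∷ map (shift h) y))) (words m n)
        ≡⟨ sumBy-cong (words m n) (λ y → 𝟙-distinct-∷-shift h x y _) ⟩
      sumBy (λ y → 𝟙 (distinct (x ∷ y)) * w (map (shift h) (x ∷ y))) (words m n)
        ∎

  sumBy-perms : ∀ n w → sumBy w (perms n) ≡ sumBy w (permsByFirst n)
  sumBy-perms zero    w = refl
  sumBy-perms (suc m) w = begin
    sumBy w (perms (suc m))                                              ≡⟨ sumBy-filterᵇ w distinct (words (suc m) (suc m)) ⟩
    sumBy (λ x → 𝟙 (distinct x) * w x) (words (suc m) (suc m))           ≡⟨ sumBy-words-suc (suc m) m _ ⟩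
    sumBelow (suc m) (λ i → sumBy (λ y → 𝟙 (distinct (suc i ∷ y)) * w (suc i ∷ y)) (words (suc m) m))
                                                                         ≡⟨ sumBelow-cong (suc m) first-letter ⟩
    sumBelow (suc m) (λ i → sumBy (w ∘ prepend (suc i)) (permsByFirst m)) ≡⟨ sumBelow-suc m _ ⟩
    sumToℕ m (λ i → sumBy (w ∘ prepend (suc i)) (permsByFirst m))       ≡⟨ sumBy-permsByFirst m w ⟨
    sumBy w (permsByFirst (suc m))                                       ∎
    where
    first-letter : ∀ i → i < suc m → sumBy (λ y → 𝟙 (distinct (suc i ∷ y)) * w (suc i ∷ y)) (words (suc m) m)
      ≡ sumBy (w ∘ prepend (suc i)) (permsByFirst m)
    first-letter i i<1+m = begin
      sumBy (λ y → 𝟙 (distinct (suc i ∷ y)) * w (suc i ∷ y)) (words (suc m) m)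
        ≡⟨ sumBy-cong (words (suc m) m) (λ y → cong (λ b → 𝟙 b * w (suc i ∷ y)) (∧-comm (avoids (suc i) y) (distinct y))) ⟩
      sumBy (λ y → 𝟙 (distinct y ∧ avoids (suc i) y) * w (suc i ∷ y)) (words (suc m) m)
        ≡⟨ sumBy-words-avoiding m m (suc i) (s≤s z≤n) i<1+m (λ y → w (suc i ∷ y)) ⟩
      sumBy (λ y → 𝟙 (distinct y) * w (prepend (suc i) y)) (words m m)
        ≡⟨ sumBy-filterᵇ (w ∘ prepend (suc i)) distinct (words m m) ⟨
      sumBy (w ∘ prepend (suc i)) (perms m)
        ≡⟨ sumBy-perms m (w ∘ prepend (suc i)) ⟩
      sumBy (w ∘ prepend (suc i)) (permsByFirst m)
        ∎

  -- The recurrence for run-sorted permutations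

  hasStats : ℕ → ℕ → List ℕ → Bool
  hasStats k r u = (runCount u ≡ᵇ k) ∧ (nRLmin u ≡ᵇ r)

  a′ : ℕ → ℕ → ℕ → ℕ
  a′ n k r = sumBy (λ u → 𝟙 (runSorted u ∧ hasStats k r u)) (permsByFirst n)

  a≡a′ : ∀ n k r → a n k r ≡ a′ n k r
  a≡a′ n k r = begin
    a n k r
      ≡⟨ length-filterᵇ _ (perms n) ⟩
    sumBy (λ u → 𝟙 (runSorted u ∧ (nRuns u ≡ᵇ k) ∧ (nRLmin u ≡ᵇ r))) (perms n)
      ≡⟨ sumBy-perms n _ ⟩
    sumBy (λ u → 𝟙 (runSorted u ∧ (nRuns u ≡ᵇ k) ∧ (nRLmin u ≡ᵇ r))) (permsByFirst n)
      ≡⟨ sumBy-cong (permsByFirst n) (λ u → cong (λ c → 𝟙 (runSorted u ∧ (c ≡ᵇ k) ∧ (nRLmin u ≡ᵇ r))) (nRuns≡runCount u)) ⟩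
    a′ n k r
      ∎

  a′⁻ : ℕ → ℕ → ℕ → ℕ
  a′⁻ n k r = sumBy (λ v → 𝟙 (runSorted v ∧ (suc (runCount v) ≡ᵇ k) ∧ (nRLmin v ≡ᵇ r))) (permsByFirst n)

  tailSorted : ℕ → ℕ → ℕ → ℕ
  tailSorted n k r = sumBy (λ u → 𝟙 (tailRunSorted u ∧ hasStats k r u)) (permsByFirst n)

  tailSortedFrom : ℕ → ℕ → ℕ → ℕ → ℕ
  tailSortedFrom n h k r = sumBy (λ u → 𝟙 (first u ≡ᵇ h) * 𝟙 (tailRunSorted u ∧ hasStats k r u)) (permsByFirst n)

  tailSortedFromAtLeast : ℕ → ℕ → ℕ → ℕ → ℕ
  tailSortedFromAtLeast n h k r = sumBy (λ u → 𝟙 (h ≤ᵇ first u) * 𝟙 (tailRunSorted u ∧ hasStats k r u)) (permsByFirst n)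

  a′≡tailSortedFrom1 : ∀ n k r → a′ (suc n) k r ≡ tailSortedFrom (suc n) 1 k r
  a′≡tailSortedFrom1 zero    k r = cong (_+ 0) (sym (*-identityˡ _))
  a′≡tailSortedFrom1 (suc n) k r = sumBy-prepend-cong (suc n) _ _ starts-with-1
    where
    starts-with-1 : ∀ i v → i ≤ suc n → Admissible (suc n) v →
      𝟙 (runSorted (prepend (suc i) v) ∧ hasStats k r (prepend (suc i) v)) ≡
      𝟙 (suc i ≡ᵇ 1) * 𝟙 (tailRunSorted (prepend (suc i) v) ∧ hasStats k r (prepend (suc i) v))
    starts-with-1 i v i≤1+n adm with admissible-∷ n v adm
    ... | y , ys , refl rewrite runSorted-prepend (suc n) (suc i) (y ∷ ys) adm (s≤s z≤n) (s≤s z≤n) (s≤s i≤1+n) with i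
    ... | suc _ = refl
    ... | zero rewrite tailRunSorted-prepend 1 y ys | ≤ᵇ-true (proj₁ (first-inRange n (y ∷ ys) adm)) = sym (*-identityˡ _)

  private
    tailSortedFrom1-drop1 : ∀ n k r → tailSortedFrom (suc (suc n)) 1 k r ≡
      sumBy (λ v → 𝟙 (tailRunSorted v ∧ (runCount v ≡ᵇ k) ∧ (suc (nRLmin v) ≡ᵇ r))) (permsByFirst (suc n))
    tailSortedFrom1-drop1 n k r = begin
      tailSortedFrom (suc (suc n)) 1 k r
        ≡⟨ sumBy-permsByFirst (suc n) _ ⟩
      sumToℕ (suc n) (λ i → sumBy (λ v → 𝟙 (suc i ≡ᵇ 1) * weight (suc i) v) (permsByFirst (suc n)))
        ≡⟨ sum-unshift n _ ⟩
      sumBy (λ v → 1 * weight 1 v) (permsByFirst (suc n)) + sumToℕ n (λ _ → sumBy (λ _ → 0) (permsByFirst (suc n)))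
        ≡⟨ cong₂ _+_ (sumBy-permsByFirst-cong (suc n) _ _ drop-1)
                     (sum-vanishes n (λ _ _ → sumBy-vanishes (permsByFirst (suc n)) (λ _ → refl))) ⟩
      sumBy (λ v → 𝟙 (tailRunSorted v ∧ (runCount v ≡ᵇ k) ∧ (suc (nRLmin v) ≡ᵇ r))) (permsByFirst (suc n)) + 0
        ≡⟨ +-identityʳ _ ⟩
      sumBy (λ v → 𝟙 (tailRunSorted v ∧ (runCount v ≡ᵇ k) ∧ (suc (nRLmin v) ≡ᵇ r))) (permsByFirst (suc n))
        ∎
      where
      weight : ℕ → List ℕ → ℕ
      weight h v = 𝟙 (tailRunSorted (prepend h v) ∧ hasStats k r (prepend h v))
      drop-1 : ∀ v → Admissible (suc n) v →
        1 * 𝟙 (tailRunSorted (prepend 1 v) ∧ hasStats k r (prepend 1 v)) ≡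
        𝟙 (tailRunSorted v ∧ (runCount v ≡ᵇ k) ∧ (suc (nRLmin v) ≡ᵇ r))
      drop-1 v adm with admissible-∷ n v adm
      ... | y , ys , refl rewrite tailRunSorted-prepend 1 y ys | runCount-prepend 1 y ys
        | nRLmin-prepend (suc n) 1 (y ∷ ys) adm (s≤s z≤n) (s≤s z≤n)
        | ≤ᵇ-true (proj₁ (first-inRange n (y ∷ ys) adm)) = *-identityˡ _

  tailSortedFrom1-suc : ∀ n k r → tailSortedFrom (suc (suc n)) 1 k (suc r) ≡ tailSorted (suc n) k r
  tailSortedFrom1-suc n k r = tailSortedFrom1-drop1 n k (suc r)

  tailSortedFrom-≥2 : ∀ n h k r → h ≤ n →
    tailSortedFrom (2 + n) (2 + h) k r ≡ tailSortedFromAtLeast (suc n) (2 + h) k r + a′⁻ (suc n) k r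
  tailSortedFrom-≥2 n h k r h≤n = begin
    tailSortedFrom (2 + n) (2 + h) k r
      ≡⟨ sumBy-permsByFirst (suc n) _ ⟩
    sumToℕ (suc n) (λ i → sumBy (λ v → 𝟙 (suc i ≡ᵇ 2 + h) * weight (suc i) v) (permsByFirst (suc n)))
      ≡⟨ sum-single≤ (suc n) (suc h) (s≤s h≤n) other-first ⟩
    sumBy (λ v → 𝟙 (h ≡ᵇ h) * weight (2 + h) v) (permsByFirst (suc n))
      ≡⟨ sumBy-permsByFirst-cong (suc n) _ _ split-on-first ⟩
    sumBy (λ v → 𝟙 (2 + h ≤ᵇ first v) * 𝟙 (tailRunSorted v ∧ hasStats k r v)
                 + 𝟙 (runSorted v ∧ (suc (runCount v) ≡ᵇ k) ∧ (nRLmin v ≡ᵇ r))) (permsByFirst (suc n))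
      ≡⟨ sumBy-+ _ _ (permsByFirst (suc n)) ⟩
    tailSortedFromAtLeast (suc n) (2 + h) k r + a′⁻ (suc n) k r
      ∎
    where
    weight : ℕ → List ℕ → ℕ
    weight h v = 𝟙 (tailRunSorted (prepend h v) ∧ hasStats k r (prepend h v))
    other-first : ∀ i → i ≢ suc h → sumBy (λ v → 𝟙 (suc i ≡ᵇ 2 + h) * weight (suc i) v) (permsByFirst (suc n)) ≡ 0
    other-first i i≢1+h rewrite ≡ᵇ-false (i≢1+h ∘ suc-injective) = sumBy-vanishes (permsByFirst (suc n)) (λ _ → refl)
    split-on-first : ∀ v → Admissible (suc n) v →
      𝟙 (h ≡ᵇ h) * 𝟙 (tailRunSorted (prepend (2 + h) v) ∧ hasStats k r (prepend (2 + h) v)) ≡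
      𝟙 (2 + h ≤ᵇ first v) * 𝟙 (tailRunSorted v ∧ hasStats k r v) + 𝟙 (runSorted v ∧ (suc (runCount v) ≡ᵇ k) ∧ (nRLmin v ≡ᵇ r))
    split-on-first v adm with admissible-∷ n v adm
    ... | y , ys , refl rewrite ≡ᵇ-refl h | *-identityˡ (weight (2 + h) (y ∷ ys))
      | tailRunSorted-prepend (2 + h) y ys | runCount-prepend (2 + h) y ys
      | nRLmin-prepend (suc n) (2 + h) (y ∷ ys) adm (s≤s z≤n) (s≤s z≤n)
      with 2 + h ≤ᵇ y in 2+h≤y
    ... | false = refl
    ... | true with runSorted (y ∷ ys) in sorted
    ... | false = trans (sym (*-identityˡ _)) (sym (+-identityʳ _))
    ... | true with runSorted⇒first≡1 (y ∷ ys) (All.map proj₁ (proj₁ adm)) (proj₂ adm (s≤s z≤n)) sorted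
    ... | refl with 2+h≤y
    ... | ()

  sumBy-byFirst : ∀ n (g : ℕ → ℕ) (w : List ℕ → ℕ) →
    sumBy (λ v → g (first v) * w v) (permsByFirst (suc n))
      ≡ sumToℕ (suc n) (λ h → g h * sumBy (λ v → 𝟙 (first v ≡ᵇ h) * w v) (permsByFirst (suc n)))
  sumBy-byFirst n g w = begin
    sumBy (λ v → g (first v) * w v) (permsByFirst (suc n))
      ≡⟨ sumBy-permsByFirst-cong (suc n) _ _ (λ v adm → sym (split v adm)) ⟩
    sumBy (λ v → sumToℕ (suc n) (λ h → g h * (𝟙 (first v ≡ᵇ h) * w v))) (permsByFirst (suc n))
      ≡⟨ sumBy-sumToℕ (suc n) _ (permsByFirst (suc n)) ⟩
    sumToℕ (suc n) (λ h → sumBy (λ v → g h * (𝟙 (first v ≡ᵇ h) * w v)) (permsByFirst (suc n)))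
      ≡⟨ sum-cong (suc n) (λ h _ → *-distribˡ-sumBy (g h) _ (permsByFirst (suc n))) ⟨
    sumToℕ (suc n) (λ h → g h * sumBy (λ v → 𝟙 (first v ≡ᵇ h) * w v) (permsByFirst (suc n)))
      ∎
    where
    at-first : ∀ v → g (first v) * (𝟙 (first v ≡ᵇ first v) * w v) ≡ g (first v) * w v
    at-first v rewrite ≡ᵇ-refl (first v) = cong (g (first v) *_) (*-identityˡ (w v))
    other-first : ∀ v h → h ≢ first v → g h * (𝟙 (first v ≡ᵇ h) * w v) ≡ 0
    other-first v h h≢first rewrite ≡ᵇ-false (≢-sym h≢first) = *-zeroʳ (g h)
    split : ∀ v → Admissible (suc n) v → sumToℕ (suc n) (λ h → g h * (𝟙 (first v ≡ᵇ h) * w v)) ≡ g (first v) * w v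
    split v adm = trans (sum-single≤ (suc n) (first v) (proj₂ (first-inRange n v adm)) (other-first v)) (at-first v)

  tailSorted≡sum : ∀ n k r → tailSorted (suc n) k r ≡ sumToℕ (suc n) (λ h → tailSortedFrom (suc n) h k r)
  tailSorted≡sum n k r = begin
    tailSorted (suc n) k r
      ≡⟨ sumBy-cong (permsByFirst (suc n)) (λ v → sym (*-identityˡ _)) ⟩
    sumBy (λ v → 1 * 𝟙 (tailRunSorted v ∧ hasStats k r v)) (permsByFirst (suc n))
      ≡⟨ sumBy-byFirst n (λ _ → 1) _ ⟩
    sumToℕ (suc n) (λ h → 1 * tailSortedFrom (suc n) h k r)
      ≡⟨ sum-cong (suc n) (λ h _ → *-identityˡ _) ⟩
    sumToℕ (suc n) (λ h → tailSortedFrom (suc n) h k r)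
      ∎

  tailSortedFromAtLeast≡sum : ∀ n h k r →
    tailSortedFromAtLeast (suc n) h k r ≡ sumToℕ (suc n) (λ h′ → 𝟙 (h ≤ᵇ h′) * tailSortedFrom (suc n) h′ k r)
  tailSortedFromAtLeast≡sum n h k r = sumBy-byFirst n (λ h′ → 𝟙 (h ≤ᵇ h′)) _

  tailSortedFrom0 : ∀ n k r → tailSortedFrom (suc n) 0 k r ≡ 0
  tailSortedFrom0 n k r = sumBy-permsByFirst-vanishes n _ (λ _ _ → refl)

  tailSortedFrom-closedForm : ℕ → ℕ → ℕ → ℕ → ℕ
  tailSortedFrom-closedForm n h k r = sumToℕ n (λ f → C (n ∸ h) f * a′⁻ (n ∸ 1 ∸ f) k r)

  private
    tailSortedFrom-closed-step : ∀ k r n h → h ≤ n →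
      (∀ x → 2 ≤ x → x ≤ suc n → tailSortedFrom (suc n) x k r ≡ tailSortedFrom-closedForm (suc n) x k r) →
      tailSortedFrom (2 + n) (2 + h) k r ≡ tailSortedFrom-closedForm (2 + n) (2 + h) k r
    tailSortedFrom-closed-step k r n h h≤n closed = begin
      tailSortedFrom (2 + n) (2 + h) k r
        ≡⟨ tailSortedFrom-≥2 n h k r h≤n ⟩
      tailSortedFromAtLeast (suc n) (2 + h) k r + a′⁻ (suc n) k r
        ≡⟨ cong (_+ a′⁻ (suc n) k r) atLeast ⟩
      sumToℕ (suc n) (λ f → C (n ∸ h) (suc f) * a′⁻ (n ∸ f) k r) + a′⁻ (suc n) k r
        ≡⟨ +-comm _ (a′⁻ (suc n) k r) ⟩
      a′⁻ (suc n) k r + sumToℕ (suc n) (λ f → C (n ∸ h) (suc f) * a′⁻ (n ∸ f) k r)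
        ≡⟨ cong (_+ sumToℕ (suc n) (λ f → C (n ∸ h) (suc f) * a′⁻ (n ∸ f) k r)) first-term ⟨
      C (n ∸ h) 0 * a′⁻ (suc n) k r + sumToℕ (suc n) (λ f → C (n ∸ h) (suc f) * a′⁻ (n ∸ f) k r)
        ≡⟨ sum-unshift (suc n) _ ⟨
      tailSortedFrom-closedForm (2 + n) (2 + h) k r
        ∎
      where
      first-term : C (n ∸ h) 0 * a′⁻ (suc n) k r ≡ a′⁻ (suc n) k r
      first-term = trans (cong (_* a′⁻ (suc n) k r) (C-zeroʳ (n ∸ h))) (*-identityˡ _)
      closed-below : ∀ x → x ≤ suc n → 𝟙 (2 + h ≤ᵇ x) * tailSortedFrom (suc n) x k r
        ≡ 𝟙 (2 + h ≤ᵇ x) * tailSortedFrom-closedForm (suc n) x k r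
      closed-below x x≤1+n with 2 + h ≤ᵇ x in 2+h≤x
      ... | false = refl
      ... | true  = cong (1 *_) (closed x (≤-trans (s≤s (s≤s z≤n)) (≤ᵇ⇒≤ (2 + h) x (subst T (sym 2+h≤x) _))) x≤1+n)
      atLeast : tailSortedFromAtLeast (suc n) (2 + h) k r ≡ sumToℕ (suc n) (λ f → C (n ∸ h) (suc f) * a′⁻ (n ∸ f) k r)
      atLeast = begin
        tailSortedFromAtLeast (suc n) (2 + h) k r
          ≡⟨ tailSortedFromAtLeast≡sum n (2 + h) k r ⟩
        sumToℕ (suc n) (λ x → 𝟙 (2 + h ≤ᵇ x) * tailSortedFrom (suc n) x k r)
          ≡⟨ sum-cong (suc n) closed-below ⟩
        sumToℕ (suc n) (λ x → 𝟙 (2 + h ≤ᵇ x) * sumToℕ (suc n) (λ f → C (suc n ∸ x) f * a′⁻ (n ∸ f) k r))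
          ≡⟨ sum-*-sum-exchange (suc n) (suc n) (λ x → 𝟙 (2 + h ≤ᵇ x)) (λ x f → C (suc n ∸ x) f) (λ f → a′⁻ (n ∸ f) k r) ⟩
        sumToℕ (suc n) (λ f → sumToℕ (suc n) (λ x → 𝟙 (2 + h ≤ᵇ x) * C (suc n ∸ x) f) * a′⁻ (n ∸ f) k r)
          ≡⟨ sum-cong (suc n) (λ f _ → cong (_* a′⁻ (n ∸ f) k r) (hockey-stick-from (suc n) (2 + h) f)) ⟩
        sumToℕ (suc n) (λ f → C (n ∸ h) (suc f) * a′⁻ (n ∸ f) k r)
          ∎

  tailSortedFrom-closed : ∀ k r n h → 2 ≤ h → h ≤ n → tailSortedFrom n h k r ≡ tailSortedFrom-closedForm n h k r
  tailSortedFrom-closed k r (suc zero)    (suc (suc h)) (s≤s (s≤s z≤n)) (s≤s ())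
  tailSortedFrom-closed k r (suc (suc n)) (suc (suc h)) (s≤s (s≤s z≤n)) (s≤s (s≤s h≤n)) =
    tailSortedFrom-closed-step k r n h h≤n (tailSortedFrom-closed k r (suc n))

  tailSorted-closed : ∀ n k r → tailSorted (suc n) k r
    ≡ tailSortedFrom (suc n) 1 k r + sumToℕ n (λ f → C n (suc f) * a′⁻ (n ∸ f) k r)
  tailSorted-closed n k r = begin
    tailSorted (suc n) k r
      ≡⟨ tailSorted≡sum n k r ⟩
    sumToℕ (suc n) (λ h → tailSortedFrom (suc n) h k r)
      ≡⟨ sum-cong (suc n) by-first ⟩
    sumToℕ (suc n) (λ h → 𝟙 (h ≡ᵇ 1) * t₁ + 𝟙 (2 ≤ᵇ h) * tailSortedFrom-closedForm (suc n) h k r)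
      ≡⟨ sum-distrib-+ (suc n) _ _ ⟩
    sumToℕ (suc n) (λ h → 𝟙 (h ≡ᵇ 1) * t₁) + sumToℕ (suc n) (λ h → 𝟙 (2 ≤ᵇ h) * tailSortedFrom-closedForm (suc n) h k r)
      ≡⟨ cong₂ _+_ only-1 (sum-*-sum-exchange (suc n) (suc n) (λ h → 𝟙 (2 ≤ᵇ h)) (λ h f → C (suc n ∸ h) f) a⁻) ⟩
    t₁ + sumToℕ (suc n) (λ f → sumToℕ (suc n) (λ h → 𝟙 (2 ≤ᵇ h) * C (suc n ∸ h) f) * a⁻ f)
      ≡⟨ cong (t₁ +_) (sum-cong (suc n) (λ f _ → cong (_* a⁻ f) (hockey-stick-from (suc n) 2 f))) ⟩
    t₁ + sumToℕ (suc n) (λ f → C n (suc f) * a⁻ f)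
      ≡⟨ cong (t₁ +_) (sum-extend n (suc n) (n≤1+n n) (λ f n<f → cong (_* a⁻ f) (C-vanishes (m<n⇒m<1+n n<f)))) ⟩
    t₁ + sumToℕ n (λ f → C n (suc f) * a⁻ f)
      ∎
    where
    t₁ : ℕ
    t₁ = tailSortedFrom (suc n) 1 k r
    a⁻ : ℕ → ℕ
    a⁻ f = a′⁻ (n ∸ f) k r
    only-1 : sumToℕ (suc n) (λ h → 𝟙 (h ≡ᵇ 1) * t₁) ≡ t₁
    only-1 = trans (sum-single≤ (suc n) 1 (s≤s z≤n) (λ h h≢1 → cong (λ b → 𝟙 b * t₁) (≡ᵇ-false h≢1))) (*-identityˡ t₁)
    by-first : ∀ h → h ≤ suc n → tailSortedFrom (suc n) h k r
      ≡ 𝟙 (h ≡ᵇ 1) * t₁ + 𝟙 (2 ≤ᵇ h) * tailSortedFrom-closedForm (suc n) h k r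
    by-first zero          _     = tailSortedFrom0 n k r
    by-first (suc zero)    _     = sym (trans (+-identityʳ _) (*-identityˡ _))
    by-first (suc (suc h)) h≤1+n =
      trans (tailSortedFrom-closed k r (suc n) (2 + h) (s≤s (s≤s z≤n)) h≤1+n) (sym (*-identityˡ _))

  runCount-∷≢0 : ∀ x w → runCount (x ∷ w) ≢ 0
  runCount-∷≢0 x []       ()
  runCount-∷≢0 x (y ∷ ys) eq = runCount-∷≢0 y ys (m+n≡0⇒n≡0 (if x <ᵇ y then 0 else 1) eq)

  nRLmin-∷≢0 : ∀ x w → nRLmin (x ∷ w) ≢ 0
  nRLmin-∷≢0 x []       ()
  nRLmin-∷≢0 x (y ∷ ys) eq = nRLmin-∷≢0 y ys (m+n≡0⇒n≡0 (if all (x <ᵇ_) (y ∷ ys) then 1 else 0) eq)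

  a′-zeroRuns : ∀ n r → a′ (suc n) 0 r ≡ 0
  a′-zeroRuns n r = sumBy-permsByFirst-vanishes n _ no-runs
    where
    no-runs : ∀ i v → 𝟙 (runSorted (prepend (suc i) v) ∧ hasStats 0 r (prepend (suc i) v)) ≡ 0
    no-runs i v rewrite ≡ᵇ-false (runCount-∷≢0 (suc i) (map (shift (suc i)) v)) = cong 𝟙 (∧-zeroʳ _)

  tailSorted-zeroRLmin : ∀ n k → tailSorted (suc n) k 0 ≡ 0
  tailSorted-zeroRLmin n k = sumBy-permsByFirst-vanishes n _ no-RLmin
    where
    no-RLmin : ∀ i v → 𝟙 (tailRunSorted (prepend (suc i) v) ∧ hasStats k 0 (prepend (suc i) v)) ≡ 0
    no-RLmin i v rewrite ≡ᵇ-false (nRLmin-∷≢0 (suc i) (map (shift (suc i)) v)) =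
      cong 𝟙 (∧-∧-false (tailRunSorted (prepend (suc i) v)) (runCount (prepend (suc i) v) ≡ᵇ k))

  a′-zeroRLmin : ∀ n k → a′ (suc n) k 0 ≡ 0
  a′-zeroRLmin n k = sumBy-permsByFirst-vanishes n _ no-RLmin
    where
    no-RLmin : ∀ i v → 𝟙 (runSorted (prepend (suc i) v) ∧ hasStats k 0 (prepend (suc i) v)) ≡ 0
    no-RLmin i v rewrite ≡ᵇ-false (nRLmin-∷≢0 (suc i) (map (shift (suc i)) v)) =
      cong 𝟙 (∧-∧-false (runSorted (prepend (suc i) v)) (runCount (prepend (suc i) v) ≡ᵇ k))

  -- The shifts of all three indices absorb the factor yz and the derivative in x.
  a′⁺ : ℕ → ℕ → ℕ → ℕ
  a′⁺ n j b = a′ (suc n) (suc j) (suc b)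

  a′⁺-zeroʳ : ∀ n j → a′⁺ (suc n) j 0 ≡ 0
  a′⁺-zeroʳ n j = begin
    a′ (2 + n) (suc j) 1                   ≡⟨ a′≡tailSortedFrom1 (suc n) (suc j) 1 ⟩
    tailSortedFrom (2 + n) 1 (suc j) 1     ≡⟨ tailSortedFrom1-suc n (suc j) 0 ⟩
    tailSorted (suc n) (suc j) 0           ≡⟨ tailSorted-zeroRLmin n (suc j) ⟩
    0                                      ∎

  a′⁺-suc : ∀ n j b → a′⁺ (suc n) j (suc b) ≡ mulL′ (λ m k → a′⁺ m k b) n j
  a′⁺-suc n j b = begin
    a′ (2 + n) (suc j) (2 + b)
      ≡⟨ a′≡tailSortedFrom1 (suc n) (suc j) (2 + b) ⟩
    tailSortedFrom (2 + n) 1 (suc j) (2 + b)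
      ≡⟨ tailSortedFrom1-suc n (suc j) (suc b) ⟩
    tailSorted (suc n) (suc j) (suc b)
      ≡⟨ tailSorted-closed n (suc j) (suc b) ⟩
    tailSortedFrom (suc n) 1 (suc j) (suc b) + sumToℕ n (λ f → C n (suc f) * a′ (n ∸ f) j (suc b))
      ≡⟨ cong₂ _+_ (sym (a′≡tailSortedFrom1 n (suc j) (suc b))) (sum-cong n (λ f _ → sym (term j f))) ⟩
    a′⁺ n j b + sumToℕ n (λ f → C n (suc f) * coefL (2 + f) (λ m k → a′⁺ m k b) (n ∸ suc f) j)
      ≡⟨ mulL′-unshift (λ m k → a′⁺ m k b) n j ⟨
    mulL′ (λ m k → a′⁺ m k b) n j
      ∎
    where
    term : ∀ j f → C n (suc f) * coefL (2 + f) (λ m k → a′⁺ m k b) (n ∸ suc f) j ≡ C n (suc f) * a′ (n ∸ f) j (suc b)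
    term j f with suc f ≤? n
    ... | no 1+f≰n rewrite C-vanishes (≰⇒> 1+f≰n) = refl
    ... | yes 1+f≤n rewrite +-∸-assoc 1 1+f≤n with j
    ...   | suc _ = refl
    ...   | zero  = cong (C n (suc f) *_) (sym (a′-zeroRuns (n ∸ suc f) (suc b)))

  powL≡b!*a′⁺ : ∀ b n j → powL b n j ≡ b ! * a′⁺ n j b
  powL≡b!*a′⁺ zero    zero    zero    = refl
  powL≡b!*a′⁺ zero    zero    (suc j) = refl
  powL≡b!*a′⁺ zero    (suc n) j       = sym (trans (+-identityʳ _) (a′⁺-zeroʳ n j))
  powL≡b!*a′⁺ (suc m) zero    j       = sym (trans (cong (λ c → suc m ! * (c + 0)) (cong 𝟙 (∧-zeroʳ (0 ≡ᵇ j)))) (*-zeroʳ (suc m !)))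
  powL≡b!*a′⁺ (suc m) (suc n) j       = begin
    powL (suc m) (suc n) j
      ≡⟨ powL-derivative m n j ⟩
    suc m * mulL′ (powL m) n j
      ≡⟨ cong (suc m *_) (mulDL-cong 1 n j (λ x y _ → powL≡b!*a′⁺ m x y)) ⟩
    suc m * mulL′ (λ x y → m ! * a′⁺ x y m) n j
      ≡⟨ cong (suc m *_) (mulDL-scale 1 (m !) (λ x y → a′⁺ x y m) n j) ⟩
    suc m * (m ! * mulL′ (λ x y → a′⁺ x y m) n j)
      ≡⟨ cong (λ c → suc m * (m ! * c)) (a′⁺-suc n j m) ⟨
    suc m * (m ! * a′⁺ (suc n) j (suc m))
      ≡⟨ *-assoc (suc m) (m !) _ ⟨
    suc m ! * a′⁺ (suc n) j (suc m)
      ∎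

module Coefficients where

  import Data.Integer as ℤ
  import Data.Integer.Properties as ℤ
  open import Data.Nat using (_!; NonZero)
  open import Data.Nat.Coprimality using (1-coprimeTo) renaming (sym to coprime-sym)
  import Data.Nat.Properties as ℕ
  open import Data.Nat.Properties using (_!≢0)
  open import Data.Rational using (ℚ; 0ℚ; 1ℚ; _+_; _*_; _/_; mkℚ)
  import Data.Rational.Properties as ℚ
  open Counting
    using (C; sumToℕ; C*[k!*[n∸k]!]≡n!; coefL; mulL; powL; a′; a≡a′; a′-zeroRuns; a′-zeroRLmin; a′⁺; powL≡b!*a′⁺)

  sumTo-zero : ∀ f → sumTo 0 f ≡ f 0
  sumTo-zero f = refl

  sumTo-suc : ∀ n f → sumTo (suc n) f ≡ sumTo n f + f (suc n)
  sumTo-suc n f = refl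

  open FiniteSum (IsCommutativeRing.isCommutativeSemiring ℚ.+-*-isCommutativeRing) sumTo sumTo-zero sumTo-suc
  open CommutativeSemigroupProperties (CommutativeMonoid.commutativeSemigroup ℚ.*-1-commutativeMonoid)
    using (interchange; x∙yz≈y∙xz; xy∙z≈y∙xz)
  open ≡-Reasoning

  ι : ℕ → ℚ
  ι n = ℤ.+ n / 1

  ι≡mkℚ : ∀ n → ι n ≡ mkℚ (ℤ.+ n) 0 (coprime-sym (1-coprimeTo n))
  ι≡mkℚ n = ℚ.normalize-coprime (coprime-sym (1-coprimeTo n))

  ι-+ : ∀ m n → ι (m ℕ.+ n) ≡ ι m + ι n
  ι-+ m n = sym (trans (cong₂ _+_ (ι≡mkℚ m) (ι≡mkℚ n))
                       (ℚ./-cong (cong₂ ℤ._+_ (ℤ.*-identityʳ (ℤ.+ m)) (ℤ.*-identityʳ (ℤ.+ n))) refl))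

  ι-* : ∀ m n → ι (m ℕ.* n) ≡ ι m * ι n
  ι-* m n = sym (trans (cong₂ _*_ (ι≡mkℚ m) (ι≡mkℚ n)) (ℚ./-cong (sym (ℤ.pos-* m n)) refl))

  ι-sum : ∀ n f → ι (sumToℕ n f) ≡ sumTo n (ι ∘ f)
  ι-sum zero    f = refl
  ι-sum (suc n) f = trans (ι-+ (sumToℕ n f) (f (suc n))) (cong (_+ ι (f (suc n))) (ι-sum n f))

  inv!*ι[n!]≡1 : ∀ n → inv! n * ι (n !) ≡ 1ℚ
  inv!*ι[n!]≡1 n = inverse (n !) {{n !≢0}}
    where
    inverse : ∀ m .{{_ : NonZero m}} → (ℤ.+ 1 / m) * ι m ≡ 1ℚ
    inverse (suc m) rewrite ι≡mkℚ (suc m) =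
      trans (cong (_* 1+m) (ℚ.normalize-coprime {1} {m} (1-coprimeTo (suc m)))) (ℚ.*-inverseˡ 1+m)
      where
      1+m : ℚ
      1+m = mkℚ (ℤ.+ suc m) 0 (coprime-sym (1-coprimeTo (suc m)))

  *-inverse-unique : ∀ x y c → x * c ≡ 1ℚ → y * c ≡ 1ℚ → x ≡ y
  *-inverse-unique x y c x*c≡1 y*c≡1 = begin
    x              ≡⟨ ℚ.*-identityʳ x ⟨
    x * 1ℚ         ≡⟨ cong (x *_) y*c≡1 ⟨
    x * (y * c)    ≡⟨ x∙yz≈y∙xz x y c ⟩
    y * (x * c)    ≡⟨ cong (y *_) x*c≡1 ⟩
    y * 1ℚ         ≡⟨ ℚ.*-identityʳ y ⟩
    y              ∎

  inv!*inv!≡C*inv! : ∀ {n i} → i ≤ n → inv! i * inv! (n ∸ i) ≡ ι (C n i) * inv! n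
  inv!*inv!≡C*inv! {n} {i} i≤n = *-inverse-unique _ _ (ι (i ! ℕ.* (n ∸ i) !)) left right
    where
    left : inv! i * inv! (n ∸ i) * ι (i ! ℕ.* (n ∸ i) !) ≡ 1ℚ
    left = begin
      inv! i * inv! (n ∸ i) * ι (i ! ℕ.* (n ∸ i) !)       ≡⟨ cong (inv! i * inv! (n ∸ i) *_) (ι-* (i !) ((n ∸ i) !)) ⟩
      inv! i * inv! (n ∸ i) * (ι (i !) * ι ((n ∸ i) !))   ≡⟨ interchange (inv! i) (inv! (n ∸ i)) (ι (i !)) (ι ((n ∸ i) !)) ⟩
      inv! i * ι (i !) * (inv! (n ∸ i) * ι ((n ∸ i) !))   ≡⟨ cong₂ _*_ (inv!*ι[n!]≡1 i) (inv!*ι[n!]≡1 (n ∸ i)) ⟩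
      1ℚ                                                  ∎
    right : ι (C n i) * inv! n * ι (i ! ℕ.* (n ∸ i) !) ≡ 1ℚ
    right = begin
      ι (C n i) * inv! n * ι (i ! ℕ.* (n ∸ i) !)          ≡⟨ xy∙z≈y∙xz (ι (C n i)) (inv! n) _ ⟩
      inv! n * (ι (C n i) * ι (i ! ℕ.* (n ∸ i) !))        ≡⟨ cong (inv! n *_) (ι-* (C n i) _) ⟨
      inv! n * ι (C n i ℕ.* (i ! ℕ.* (n ∸ i) !))          ≡⟨ cong (λ m → inv! n * ι m) (C*[k!*[n∸k]!]≡n! i≤n) ⟩
      inv! n * ι (n !)                                    ≡⟨ inv!*ι[n!]≡1 n ⟩
      1ℚ                                                  ∎

  ι[1+n]*inv![1+n]≡inv!n : ∀ n → ι (suc n) * inv! (suc n) ≡ inv! n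
  ι[1+n]*inv![1+n]≡inv!n n = *-inverse-unique _ _ (ι (n !)) (begin
    ι (suc n) * inv! (suc n) * ι (n !)        ≡⟨ xy∙z≈y∙xz (ι (suc n)) (inv! (suc n)) (ι (n !)) ⟩
    inv! (suc n) * (ι (suc n) * ι (n !))      ≡⟨ cong (inv! (suc n) *_) (ι-* (suc n) (n !)) ⟨
    inv! (suc n) * ι (suc n !)                ≡⟨ inv!*ι[n!]≡1 (suc n) ⟩
    1ℚ                                        ∎) (inv!*ι[n!]≡1 n)

  when : Bool → ℚ → ℚ
  when b x = if b then x else 0ℚ

  when-0ℚ : ∀ b → when b 0ℚ ≡ 0ℚ
  when-0ℚ true  = refl
  when-0ℚ false = refl

  sum-when : ∀ n b (f : ℕ → ℚ) → sumTo n (λ i → when b (f i)) ≡ when b (sumTo n f)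
  sum-when n true  f = refl
  sum-when n false f = sum-vanishes n (λ _ _ → refl)

  infix 4 _≐_
  _≐_ : Series → Series → Set
  F ≐ G = ∀ n k r → F n k r ≡ G n k r

  ⊗-cong : ∀ {F F′ G G′} → F ≐ F′ → G ≐ G′ → F ⊗ G ≐ F′ ⊗ G′
  ⊗-cong F≐F′ G≐G′ n k r = sum-cong n λ i _ → sum-cong k λ l _ → sum-cong r λ q _ →
    cong₂ _*_ (F≐F′ i l q) (G≐G′ (n ∸ i) (k ∸ l) (r ∸ q))

  ⊗-distribʳ-⊕ : ∀ F F′ G → (F ⊕ F′) ⊗ G ≐ λ n k r → (F ⊗ G) n k r + (F′ ⊗ G) n k r
  ⊗-distribʳ-⊕ F F′ G n k r =
    trans (sum-cong n λ i _ → trans (sum-cong k λ l _ → trans (sum-cong r λ q _ →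
      ℚ.*-distribʳ-+ (G (n ∸ i) (k ∸ l) (r ∸ q)) (F i l q) (F′ i l q)) (sum-distrib-+ r _ _)) (sum-distrib-+ k _ _))
    (sum-distrib-+ n _ _)

  ⊗-concentrated : ∀ F G n k r b c → (∀ i l q → l ≢ b → F i l q ≡ 0ℚ) → (∀ i q → q ≢ c → F i b q ≡ 0ℚ) →
    (F ⊗ G) n k r ≡ when (b ≤ᵇ k) (when (c ≤ᵇ r) (sumTo n (λ i → F i b c * G (n ∸ i) (k ∸ b) (r ∸ c))))
  ⊗-concentrated F G n k r b c F≗0ˡ F≗0ʳ = begin
    (F ⊗ G) n k r
      ≡⟨ sum-cong n (λ i _ → trans (sum-single k b (other-l i)) (cong (when (b ≤ᵇ k)) (sum-single r c (other-q i)))) ⟩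
    sumTo n (λ i → when (b ≤ᵇ k) (when (c ≤ᵇ r) (F i b c * G (n ∸ i) (k ∸ b) (r ∸ c))))
      ≡⟨ sum-when n (b ≤ᵇ k) _ ⟩
    when (b ≤ᵇ k) (sumTo n (λ i → when (c ≤ᵇ r) (F i b c * G (n ∸ i) (k ∸ b) (r ∸ c))))
      ≡⟨ cong (when (b ≤ᵇ k)) (sum-when n (c ≤ᵇ r) _) ⟩
    when (b ≤ᵇ k) (when (c ≤ᵇ r) (sumTo n (λ i → F i b c * G (n ∸ i) (k ∸ b) (r ∸ c))))
      ∎
    where
    other-l : ∀ i l → l ≢ b → sumTo r (λ q → F i l q * G (n ∸ i) (k ∸ l) (r ∸ q)) ≡ 0ℚ
    other-l i l l≢b = sum-vanishes r λ q _ →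
      trans (cong (_* G (n ∸ i) (k ∸ l) (r ∸ q)) (F≗0ˡ i l q l≢b)) (ℚ.*-zeroˡ (G (n ∸ i) (k ∸ l) (r ∸ q)))
    other-q : ∀ i q → q ≢ c → F i b q * G (n ∸ i) (k ∸ b) (r ∸ q) ≡ 0ℚ
    other-q i q q≢c = trans (cong (_* G (n ∸ i) (k ∸ b) (r ∸ q)) (F≗0ʳ i q q≢c)) (ℚ.*-zeroˡ (G (n ∸ i) (k ∸ b) (r ∸ q)))

  monomial : ℕ → ℕ → ℕ → ℚ → Series
  monomial a b c v n k r = when ((n ≡ᵇ a) ∧ (k ≡ᵇ b) ∧ (r ≡ᵇ c)) v

  monomial-⊗ : ∀ a b c v G n k r → (monomial a b c v ⊗ G) n k r ≡
    when (b ≤ᵇ k) (when (c ≤ᵇ r) (when (a ≤ᵇ n) (v * G (n ∸ a) (k ∸ b) (r ∸ c))))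
  monomial-⊗ a b c v G n k r = begin
    (monomial a b c v ⊗ G) n k r
      ≡⟨ ⊗-concentrated (monomial a b c v) G n k r b c other-k other-r ⟩
    when (b ≤ᵇ k) (when (c ≤ᵇ r) (sumTo n (λ i → monomial a b c v i b c * G (n ∸ i) (k ∸ b) (r ∸ c))))
      ≡⟨ cong (λ s → when (b ≤ᵇ k) (when (c ≤ᵇ r) s)) (sum-single n a other-n) ⟩
    when (b ≤ᵇ k) (when (c ≤ᵇ r) (when (a ≤ᵇ n) (monomial a b c v a b c * G (n ∸ a) (k ∸ b) (r ∸ c))))
      ≡⟨ cong (λ x → when (b ≤ᵇ k) (when (c ≤ᵇ r) (when (a ≤ᵇ n) (x * G (n ∸ a) (k ∸ b) (r ∸ c))))) at-abc ⟩
    when (b ≤ᵇ k) (when (c ≤ᵇ r) (when (a ≤ᵇ n) (v * G (n ∸ a) (k ∸ b) (r ∸ c))))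
      ∎
    where
    other-k : ∀ i l q → l ≢ b → monomial a b c v i l q ≡ 0ℚ
    other-k i l q l≢b rewrite ≡ᵇ-false l≢b = cong (λ β → when β v) (∧-zeroʳ (i ≡ᵇ a))
    other-r : ∀ i q → q ≢ c → monomial a b c v i b q ≡ 0ℚ
    other-r i q q≢c rewrite ≡ᵇ-false q≢c | ≡ᵇ-refl b = cong (λ β → when β v) (∧-zeroʳ (i ≡ᵇ a))
    other-n : ∀ i → i ≢ a → monomial a b c v i b c * G (n ∸ i) (k ∸ b) (r ∸ c) ≡ 0ℚ
    other-n i i≢a rewrite ≡ᵇ-false i≢a = ℚ.*-zeroˡ (G (n ∸ i) (k ∸ b) (r ∸ c))
    at-abc : monomial a b c v a b c ≡ v
    at-abc rewrite ≡ᵇ-refl a | ≡ᵇ-refl b | ≡ᵇ-refl c = refl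

  X≐monomial : X ≐ monomial 1 0 0 1ℚ
  X≐monomial zero          l       q       = refl
  X≐monomial (suc zero)    zero    zero    = refl
  X≐monomial (suc zero)    zero    (suc q) = refl
  X≐monomial (suc zero)    (suc l) q       = refl
  X≐monomial (suc (suc i)) l       q       = refl

  Y≐monomial : Y ≐ monomial 0 1 0 1ℚ
  Y≐monomial zero    zero          q       = refl
  Y≐monomial zero    (suc zero)    zero    = refl
  Y≐monomial zero    (suc zero)    (suc q) = refl
  Y≐monomial zero    (suc (suc l)) q       = refl
  Y≐monomial (suc i) l             q       = refl

  Z≐monomial : Z ≐ monomial 0 0 1 1ℚ
  Z≐monomial zero    zero    zero          = refl
  Z≐monomial zero    zero    (suc zero)    = refl
  Z≐monomial zero    zero    (suc (suc q)) = refl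
  Z≐monomial zero    (suc l) q             = refl
  Z≐monomial (suc i) l       q             = refl

  X⊗Z≐monomial : X ⊗ Z ≐ monomial 1 0 1 1ℚ
  X⊗Z≐monomial n k r =
    trans (⊗-cong {X} {monomial 1 0 0 1ℚ} {Z} {Z} X≐monomial (λ _ _ _ → refl) n k r)
          (trans (monomial-⊗ 1 0 0 1ℚ Z n k r) (shifted n))
    where
    shifted : ∀ n → when (1 ≤ᵇ n) (1ℚ * Z (n ∸ 1) k r) ≡ monomial 1 0 1 1ℚ n k r
    shifted zero    = refl
    shifted (suc n) = trans (ℚ.*-identityˡ (Z n k r)) (Z≐monomial n k r)

  Y⊗Z≐monomial : Y ⊗ Z ≐ monomial 0 1 1 1ℚ
  Y⊗Z≐monomial n k r =
    trans (⊗-cong {Y} {monomial 0 1 0 1ℚ} {Z} {Z} Y≐monomial (λ _ _ _ → refl) n k r)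
          (trans (monomial-⊗ 0 1 0 1ℚ Z n k r) (shifted k))
    where
    shifted : ∀ k → when (1 ≤ᵇ k) (1ℚ * Z n (k ∸ 1) r) ≡ monomial 0 1 1 1ℚ n k r
    shifted zero    = sym (cong (λ β → when β 1ℚ) (∧-zeroʳ (n ≡ᵇ 0)))
    shifted (suc k) = trans (ℚ.*-identityˡ (Z n k r)) (Z≐monomial n k r)

  Y⊗Z⊗-coefficient : ∀ H n k r → (Y ⊗ Z ⊗ H) n k r ≡ when (1 ≤ᵇ k) (when (1 ≤ᵇ r) (H n (k ∸ 1) (r ∸ 1)))
  Y⊗Z⊗-coefficient H n k r = trans (⊗-cong {Y ⊗ Z} {monomial 0 1 1 1ℚ} {H} {H} Y⊗Z≐monomial (λ _ _ _ → refl) n k r)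
    (trans (monomial-⊗ 0 1 1 1ℚ H n k r) (cong (λ x → when (1 ≤ᵇ k) (when (1 ≤ᵇ r) x)) (ℚ.*-identityˡ _)))

  xCoefficient expTailCoefficient : ℕ → ℚ
  xCoefficient 1 = 1ℚ
  xCoefficient _ = 0ℚ
  expTailCoefficient zero          = 0ℚ
  expTailCoefficient (suc zero)    = 0ℚ
  expTailCoefficient (suc (suc i)) = inv! (suc (suc i))

  xz yzExpTail : Series
  xz        n k r = when ((k ≡ᵇ 0) ∧ (r ≡ᵇ 1)) (xCoefficient n)
  yzExpTail n k r = when ((k ≡ᵇ 1) ∧ (r ≡ᵇ 1)) (expTailCoefficient n)

  exponent≐xz⊕yzExpTail : exponent ≐ xz ⊕ yzExpTail
  exponent≐xz⊕yzExpTail n k r = begin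
    exponent n k r
      ≡⟨ cong₂ (λ a b → a + (Y ⊗ Z ⊗ (⊖ X ⊕ ⊖ const 1ℚ)) n k r + b) (X⊗Z≐monomial n k r) (Y⊗Z⊗-coefficient expX n k r) ⟩
    monomial 1 0 1 1ℚ n k r + (Y ⊗ Z ⊗ (⊖ X ⊕ ⊖ const 1ℚ)) n k r + when (1 ≤ᵇ k) (when (1 ≤ᵇ r) (expX n (k ∸ 1) (r ∸ 1)))
      ≡⟨ cong (λ a → monomial 1 0 1 1ℚ n k r + a + (when (1 ≤ᵇ k) (when (1 ≤ᵇ r) (expX n (k ∸ 1) (r ∸ 1)))))
              (Y⊗Z⊗-coefficient (⊖ X ⊕ ⊖ const 1ℚ) n k r) ⟩
    monomial 1 0 1 1ℚ n k r + when (1 ≤ᵇ k) (when (1 ≤ᵇ r) ((⊖ X ⊕ ⊖ const 1ℚ) n (k ∸ 1) (r ∸ 1)))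
      + when (1 ≤ᵇ k) (when (1 ≤ᵇ r) (expX n (k ∸ 1) (r ∸ 1)))
      ≡⟨ by-cases n k r ⟩
    (xz ⊕ yzExpTail) n k r
      ∎
    where
    by-cases : ∀ n k r → monomial 1 0 1 1ℚ n k r + when (1 ≤ᵇ k) (when (1 ≤ᵇ r) ((⊖ X ⊕ ⊖ const 1ℚ) n (k ∸ 1) (r ∸ 1)))
      + when (1 ≤ᵇ k) (when (1 ≤ᵇ r) (expX n (k ∸ 1) (r ∸ 1))) ≡ (xz ⊕ yzExpTail) n k r
    by-cases zero          zero          zero          = refl
    by-cases zero          zero          (suc zero)    = refl
    by-cases zero          zero          (suc (suc r)) = refl
    by-cases zero          (suc zero)    zero          = refl
    by-cases zero          (suc zero)    (suc zero)    = refl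
    by-cases zero          (suc zero)    (suc (suc r)) = refl
    by-cases zero          (suc (suc k)) zero          = refl
    by-cases zero          (suc (suc k)) (suc zero)    = refl
    by-cases zero          (suc (suc k)) (suc (suc r)) = refl
    by-cases (suc zero)    zero          zero          = refl
    by-cases (suc zero)    zero          (suc zero)    = refl
    by-cases (suc zero)    zero          (suc (suc r)) = refl
    by-cases (suc zero)    (suc zero)    zero          = refl
    by-cases (suc zero)    (suc zero)    (suc zero)    = refl
    by-cases (suc zero)    (suc zero)    (suc (suc r)) = refl
    by-cases (suc zero)    (suc (suc k)) zero          = refl
    by-cases (suc zero)    (suc (suc k)) (suc zero)    = refl
    by-cases (suc zero)    (suc (suc k)) (suc (suc r)) = refl
    by-cases (suc (suc n)) zero          zero          = refl
    by-cases (suc (suc n)) zero          (suc zero)    = refl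
    by-cases (suc (suc n)) zero          (suc (suc r)) = refl
    by-cases (suc (suc n)) (suc zero)    zero          = refl
    by-cases (suc (suc n)) (suc zero)    (suc zero)    = refl
    by-cases (suc (suc n)) (suc zero)    (suc (suc r)) = refl
    by-cases (suc (suc n)) (suc (suc k)) zero          = refl
    by-cases (suc (suc n)) (suc (suc k)) (suc zero)    = refl
    by-cases (suc (suc n)) (suc (suc k)) (suc (suc r)) = refl

  inv!*[ι*inv!]≡ι[C*]*inv! : ∀ {n i} m → i ≤ n → inv! i * (ι m * inv! (n ∸ i)) ≡ ι (C n i ℕ.* m) * inv! n
  inv!*[ι*inv!]≡ι[C*]*inv! {n} {i} m i≤n = begin
    inv! i * (ι m * inv! (n ∸ i))     ≡⟨ x∙yz≈y∙xz (inv! i) (ι m) (inv! (n ∸ i)) ⟩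
    ι m * (inv! i * inv! (n ∸ i))     ≡⟨ cong (ι m *_) (inv!*inv!≡C*inv! i≤n) ⟩
    ι m * (ι (C n i) * inv! n)        ≡⟨ x∙yz≈y∙xz (ι m) (ι (C n i)) (inv! n) ⟩
    ι (C n i) * (ι m * inv! n)        ≡⟨ ℚ.*-assoc (ι (C n i)) (ι m) (inv! n) ⟨
    ι (C n i) * ι m * inv! n          ≡⟨ cong (_* inv! n) (ι-* (C n i) m) ⟨
    ι (C n i ℕ.* m) * inv! n          ∎

  xz⊕yzExpTail-term : ∀ F n j i → i ≤ n →
    xCoefficient i * (ι (F (n ∸ i) j) * inv! (n ∸ i)) + when (1 ≤ᵇ j) (expTailCoefficient i * (ι (F (n ∸ i) (j ∸ 1)) * inv! (n ∸ i)))
      ≡ ι (C n i ℕ.* coefL i F (n ∸ i) j) * inv! n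
  xz⊕yzExpTail-term F n j zero _ = trans (vanishes j) (sym (trans (cong (λ m → ι m * inv! n) (ℕ.*-zeroʳ (C n 0))) (ℚ.*-zeroˡ (inv! n))))
    where
    vanishes : ∀ j → 0ℚ * (ι (F n j) * inv! n) + when (1 ≤ᵇ j) (0ℚ * (ι (F n (j ∸ 1)) * inv! n)) ≡ 0ℚ
    vanishes zero    = cong (_+ 0ℚ) (ℚ.*-zeroˡ (ι (F n 0) * inv! n))
    vanishes (suc j) = cong₂ _+_ (ℚ.*-zeroˡ (ι (F n (suc j)) * inv! n)) (ℚ.*-zeroˡ (ι (F n j) * inv! n))
  xz⊕yzExpTail-term F n j (suc zero) 1≤n = begin
    1ℚ * (ι (F (n ∸ 1) j) * inv! (n ∸ 1)) + when (1 ≤ᵇ j) (0ℚ * (ι (F (n ∸ 1) (j ∸ 1)) * inv! (n ∸ 1)))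
      ≡⟨ cong (λ x → 1ℚ * (ι (F (n ∸ 1) j) * inv! (n ∸ 1)) + x) (vanishes j) ⟩
    1ℚ * (ι (F (n ∸ 1) j) * inv! (n ∸ 1)) + 0ℚ
      ≡⟨ ℚ.+-identityʳ _ ⟩
    inv! 1 * (ι (F (n ∸ 1) j) * inv! (n ∸ 1))
      ≡⟨ inv!*[ι*inv!]≡ι[C*]*inv! (F (n ∸ 1) j) 1≤n ⟩
    ι (C n 1 ℕ.* F (n ∸ 1) j) * inv! n
      ∎
    where
    vanishes : ∀ j → when (1 ≤ᵇ j) (0ℚ * (ι (F (n ∸ 1) (j ∸ 1)) * inv! (n ∸ 1))) ≡ 0ℚ
    vanishes zero    = refl
    vanishes (suc j) = ℚ.*-zeroˡ (ι (F (n ∸ 1) j) * inv! (n ∸ 1))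
  xz⊕yzExpTail-term F n zero (suc (suc i)) _ = begin
    0ℚ * (ι (F (n ∸ 2+i) 0) * inv! (n ∸ 2+i)) + 0ℚ  ≡⟨ cong (_+ 0ℚ) (ℚ.*-zeroˡ (ι (F (n ∸ 2+i) 0) * inv! (n ∸ 2+i))) ⟩
    0ℚ                                              ≡⟨ ℚ.*-zeroˡ (inv! n) ⟨
    ι 0 * inv! n                                    ≡⟨ cong (λ m → ι m * inv! n) (ℕ.*-zeroʳ (C n 2+i)) ⟨
    ι (C n 2+i ℕ.* 0) * inv! n                      ∎
    where
    2+i : ℕ
    2+i = suc (suc i)
  xz⊕yzExpTail-term F n (suc j) (suc (suc i)) 2+i≤n = begin
    0ℚ * (ι (F (n ∸ 2+i) (suc j)) * inv! (n ∸ 2+i)) + inv! 2+i * (ι (F (n ∸ 2+i) j) * inv! (n ∸ 2+i))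
      ≡⟨ cong (_+ inv! 2+i * (ι (F (n ∸ 2+i) j) * inv! (n ∸ 2+i))) (ℚ.*-zeroˡ (ι (F (n ∸ 2+i) (suc j)) * inv! (n ∸ 2+i))) ⟩
    0ℚ + inv! 2+i * (ι (F (n ∸ 2+i) j) * inv! (n ∸ 2+i))
      ≡⟨ ℚ.+-identityˡ (inv! 2+i * (ι (F (n ∸ 2+i) j) * inv! (n ∸ 2+i))) ⟩
    inv! 2+i * (ι (F (n ∸ 2+i) j) * inv! (n ∸ 2+i))
      ≡⟨ inv!*[ι*inv!]≡ι[C*]*inv! (F (n ∸ 2+i) j) 2+i≤n ⟩
    ι (C n 2+i ℕ.* F (n ∸ 2+i) j) * inv! n
      ∎
    where
    2+i : ℕ
    2+i = suc (suc i)

  xz-⊗ : ∀ G n j b → (xz ⊗ G) n j b ≡ when (1 ≤ᵇ b) (sumTo n (λ i → xCoefficient i * G (n ∸ i) j (b ∸ 1)))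
  xz-⊗ G n j b = ⊗-concentrated xz G n j b 0 1
    (λ i l q l≢0 → cong (λ β → when β (xCoefficient i)) (cong (_∧ (q ≡ᵇ 1)) (≡ᵇ-false l≢0)))
    (λ i q q≢1 → cong (λ β → when β (xCoefficient i)) (≡ᵇ-false q≢1))

  yzExpTail-⊗ : ∀ G n j b → (yzExpTail ⊗ G) n j b ≡
    when (1 ≤ᵇ j) (when (1 ≤ᵇ b) (sumTo n (λ i → expTailCoefficient i * G (n ∸ i) (j ∸ 1) (b ∸ 1))))
  yzExpTail-⊗ G n j b = ⊗-concentrated yzExpTail G n j b 1 1
    (λ i l q l≢1 → cong (λ β → when β (expTailCoefficient i)) (cong (_∧ (q ≡ᵇ 1)) (≡ᵇ-false l≢1)))
    (λ i q q≢1 → cong (λ β → when β (expTailCoefficient i)) (≡ᵇ-false q≢1))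

  xz⊕yzExpTail-convolution : ∀ F n j →
    sumTo n (λ i → xCoefficient i * (ι (F (n ∸ i) j) * inv! (n ∸ i)))
      + when (1 ≤ᵇ j) (sumTo n (λ i → expTailCoefficient i * (ι (F (n ∸ i) (j ∸ 1)) * inv! (n ∸ i))))
      ≡ ι (mulL F n j) * inv! n
  xz⊕yzExpTail-convolution F n j = begin
    sumTo n (λ i → xCoefficient i * (ι (F (n ∸ i) j) * inv! (n ∸ i)))
      + when (1 ≤ᵇ j) (sumTo n (λ i → expTailCoefficient i * (ι (F (n ∸ i) (j ∸ 1)) * inv! (n ∸ i))))
      ≡⟨ cong (sumTo n (λ i → xCoefficient i * (ι (F (n ∸ i) j) * inv! (n ∸ i))) +_) (sum-when n (1 ≤ᵇ j) _) ⟨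
    sumTo n (λ i → xCoefficient i * (ι (F (n ∸ i) j) * inv! (n ∸ i)))
      + sumTo n (λ i → when (1 ≤ᵇ j) (expTailCoefficient i * (ι (F (n ∸ i) (j ∸ 1)) * inv! (n ∸ i))))
      ≡⟨ sum-distrib-+ n _ _ ⟨
    sumTo n (λ i → xCoefficient i * (ι (F (n ∸ i) j) * inv! (n ∸ i))
      + (when (1 ≤ᵇ j) (expTailCoefficient i * (ι (F (n ∸ i) (j ∸ 1)) * inv! (n ∸ i)))))
      ≡⟨ sum-cong n (xz⊕yzExpTail-term F n j) ⟩
    sumTo n (λ i → ι (C n i ℕ.* coefL i F (n ∸ i) j) * inv! n)
      ≡⟨ *-distribʳ-sum n (inv! n) _ ⟨
    sumTo n (λ i → ι (C n i ℕ.* coefL i F (n ∸ i) j)) * inv! n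
      ≡⟨ cong (_* inv! n) (ι-sum n _) ⟨
    ι (mulL F n j) * inv! n
      ∎

  -- The exponent is z·L, so its m-th power is zᵐLᵐ.
  pow-xz⊕yzExpTail : ∀ m n j b → pow (xz ⊕ yzExpTail) m n j b ≡ when (b ≡ᵇ m) (ι (powL m n j) * inv! n)
  pow-xz⊕yzExpTail zero zero    zero    zero    = refl
  pow-xz⊕yzExpTail zero zero    zero    (suc b) = refl
  pow-xz⊕yzExpTail zero zero    (suc j) zero    = refl
  pow-xz⊕yzExpTail zero zero    (suc j) (suc b) = refl
  pow-xz⊕yzExpTail zero (suc n) j       zero    = sym (ℚ.*-zeroˡ (inv! (suc n)))
  pow-xz⊕yzExpTail zero (suc n) j       (suc b) = refl
  pow-xz⊕yzExpTail (suc m) n j b = begin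
    ((xz ⊕ yzExpTail) ⊗ P) n j b                     ≡⟨ ⊗-distribʳ-⊕ xz yzExpTail P n j b ⟩
    (xz ⊗ P) n j b + (yzExpTail ⊗ P) n j b           ≡⟨ cong₂ _+_ (xz-⊗ P n j b) (yzExpTail-⊗ P n j b) ⟩
    when (1 ≤ᵇ b) (sumTo n (λ i → xCoefficient i * P (n ∸ i) j (b ∸ 1)))
      + when (1 ≤ᵇ j) (when (1 ≤ᵇ b) (sumTo n (λ i → expTailCoefficient i * P (n ∸ i) (j ∸ 1) (b ∸ 1))))
                                                     ≡⟨ by-RLmin b ⟩
    when (b ≡ᵇ suc m) (ι (powL (suc m) n j) * inv! n)
                                                     ∎
    where
    P : Series
    P = pow (xz ⊕ yzExpTail) m
    by-RLmin : ∀ b →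
      when (1 ≤ᵇ b) (sumTo n (λ i → xCoefficient i * P (n ∸ i) j (b ∸ 1)))
        + when (1 ≤ᵇ j) (when (1 ≤ᵇ b) (sumTo n (λ i → expTailCoefficient i * P (n ∸ i) (j ∸ 1) (b ∸ 1))))
        ≡ when (b ≡ᵇ suc m) (ι (powL (suc m) n j) * inv! n)
    by-RLmin zero = cong (0ℚ +_) (when-0ℚ (1 ≤ᵇ j))
    by-RLmin (suc b) = trans
      (cong₂ (λ s t → s + (when (1 ≤ᵇ j) t))
             (sum-cong n (λ i _ → cong (xCoefficient i *_) (pow-xz⊕yzExpTail m (n ∸ i) j b)))
             (sum-cong n (λ i _ → cong (expTailCoefficient i *_) (pow-xz⊕yzExpTail m (n ∸ i) (j ∸ 1) b))))
      (collect (b ≡ᵇ m))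
      where
      collect : ∀ β →
        sumTo n (λ i → xCoefficient i * (when β (ι (powL m (n ∸ i) j) * inv! (n ∸ i))))
          + when (1 ≤ᵇ j) (sumTo n (λ i → expTailCoefficient i * (when β (ι (powL m (n ∸ i) (j ∸ 1)) * inv! (n ∸ i)))))
          ≡ when β (ι (powL (suc m) n j) * inv! n)
      collect true  = xz⊕yzExpTail-convolution (powL m) n j
      collect false = cong₂ _+_ (sum-vanishes n (λ i _ → ℚ.*-zeroʳ (xCoefficient i)))
        (trans (cong (when (1 ≤ᵇ j)) (sum-vanishes n (λ i _ → ℚ.*-zeroʳ (expTailCoefficient i)))) (when-0ℚ (1 ≤ᵇ j)))

  expS-exponent : ∀ n j b → expS exponent n j b ≡ ι (a′⁺ n j b) * inv! n
  expS-exponent n j b = begin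
    sumTo (n ℕ.+ j ℕ.+ b) (λ m → inv! m * pow exponent m n j b)
      ≡⟨ sum-cong (n ℕ.+ j ℕ.+ b) (λ m _ → cong (inv! m *_) (trans (pow-cong m n j b) (pow-xz⊕yzExpTail m n j b))) ⟩
    sumTo (n ℕ.+ j ℕ.+ b) (λ m → inv! m * (when (b ≡ᵇ m) (ι (powL m n j) * inv! n)))
      ≡⟨ sum-single≤ (n ℕ.+ j ℕ.+ b) b (ℕ.m≤n+m b (n ℕ.+ j)) other-m ⟩
    inv! b * (when (b ≡ᵇ b) (ι (powL b n j) * inv! n))
      ≡⟨ cong (λ β → inv! b * (when β (ι (powL b n j) * inv! n))) (≡ᵇ-refl b) ⟩
    inv! b * (ι (powL b n j) * inv! n)
      ≡⟨ cong (λ m → inv! b * (ι m * inv! n)) (powL≡b!*a′⁺ b n j) ⟩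
    inv! b * (ι (b ! ℕ.* a′⁺ n j b) * inv! n)
      ≡⟨ cong (λ q → inv! b * (q * inv! n)) (ι-* (b !) (a′⁺ n j b)) ⟩
    inv! b * (ι (b !) * ι (a′⁺ n j b) * inv! n)
      ≡⟨ cong (inv! b *_) (ℚ.*-assoc (ι (b !)) (ι (a′⁺ n j b)) (inv! n)) ⟩
    inv! b * (ι (b !) * (ι (a′⁺ n j b) * inv! n))
      ≡⟨ ℚ.*-assoc (inv! b) (ι (b !)) _ ⟨
    inv! b * ι (b !) * (ι (a′⁺ n j b) * inv! n)
      ≡⟨ cong (_* (ι (a′⁺ n j b) * inv! n)) (inv!*ι[n!]≡1 b) ⟩
    1ℚ * (ι (a′⁺ n j b) * inv! n)
      ≡⟨ ℚ.*-identityˡ _ ⟩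
    ι (a′⁺ n j b) * inv! n
      ∎
    where
    pow-cong : ∀ m → pow exponent m ≐ pow (xz ⊕ yzExpTail) m
    pow-cong zero    = λ _ _ _ → refl
    pow-cong (suc m) = ⊗-cong {exponent} {xz ⊕ yzExpTail} {pow exponent m} {pow (xz ⊕ yzExpTail) m} exponent≐xz⊕yzExpTail (pow-cong m)
    other-m : ∀ m → m ≢ b → inv! m * (when (b ≡ᵇ m) (ι (powL m n j) * inv! n)) ≡ 0ℚ
    other-m m m≢b rewrite ≡ᵇ-false (≢-sym m≢b) = ℚ.*-zeroʳ (inv! m)

  ∂xA-coefficient : ∀ n k r → ∂x A n k r ≡ when (1 ≤ᵇ k) (when (1 ≤ᵇ r) (expS exponent n (k ∸ 1) (r ∸ 1)))
  ∂xA-coefficient n k r = begin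
    ι (suc n) * (ι (a (suc n) k r) * inv! (suc n))    ≡⟨ x∙yz≈y∙xz (ι (suc n)) (ι (a (suc n) k r)) (inv! (suc n)) ⟩
    ι (a (suc n) k r) * (ι (suc n) * inv! (suc n))    ≡⟨ cong₂ _*_ (cong ι (a≡a′ (suc n) k r)) (ι[1+n]*inv![1+n]≡inv!n n) ⟩
    ι (a′ (suc n) k r) * inv! n                       ≡⟨ by-runs-and-minima k r ⟩
    when (1 ≤ᵇ k) (when (1 ≤ᵇ r) (expS exponent n (k ∸ 1) (r ∸ 1)))   ∎
    where
    by-runs-and-minima : ∀ k r → ι (a′ (suc n) k r) * inv! n
      ≡ when (1 ≤ᵇ k) (when (1 ≤ᵇ r) (expS exponent n (k ∸ 1) (r ∸ 1)))
    by-runs-and-minima zero    r       = trans (cong (λ m → ι m * inv! n) (a′-zeroRuns n r)) (ℚ.*-zeroˡ (inv! n))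
    by-runs-and-minima (suc j) zero    = trans (cong (λ m → ι m * inv! n) (a′-zeroRLmin n (suc j))) (ℚ.*-zeroˡ (inv! n))
    by-runs-and-minima (suc j) (suc b) = sym (expS-exponent n j b)

  ∂xA-at0 : ∀ k r → ∂x A 0 k r ≡ monomial 0 1 1 1ℚ 0 k r
  ∂xA-at0 zero          zero          = refl
  ∂xA-at0 zero          (suc zero)    = refl
  ∂xA-at0 zero          (suc (suc r)) = refl
  ∂xA-at0 (suc zero)    zero          = refl
  ∂xA-at0 (suc zero)    (suc zero)    = refl
  ∂xA-at0 (suc zero)    (suc (suc r)) = refl
  ∂xA-at0 (suc (suc k)) zero          = refl
  ∂xA-at0 (suc (suc k)) (suc zero)    = refl
  ∂xA-at0 (suc (suc k)) (suc (suc r)) = refl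

open Coefficients using (∂xA-coefficient; ∂xA-at0; Y⊗Z⊗-coefficient; Y⊗Z≐monomial)

theorem30 : ((n k r : ℕ) → ∂x A n k r ≡ (Y ⊗ Z ⊗ expS exponent) n k r)
    × ((k r : ℕ) → ∂x A 0 k r ≡ (Y ⊗ Z) 0 k r)
theorem30 = (λ n k r → trans (∂xA-coefficient n k r) (sym (Y⊗Z⊗-coefficient (expS exponent) n k r)))
          , (λ k r → trans (∂xA-at0 k r) (sym (Y⊗Z≐monomial 0 k r)))
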